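{- For each natural number $n$: (i) the total domination polynomial of the $n$-book graph $B_n$ is unimodal; (ii) the total domination polynomial of the generalized friendship graph $F_{n,4}$ is unimodal.
   Context: The $n$-book graph $B_n$ is obtained by taking $n$ copies of the 4-cycle $C_4$ and identifying them along a common edge $\{u,v\}$. The generalized friendship graph $F_{n,4}$ consists of $n$ copies of the 4-cycle $C_4$ sharing exactly one common vertex. A set $D\subseteq V(G)$ is a total dominating set if every vertex is adjacent to some vertex of $D$; the total domination polynomial is $D_t(G,x)=\sum_i d_t(G,i)x^i$ with $d_t(G,i)$ the number of total dominating sets of size $i$. A polynomial $\sum_{k=0}^N a_kx^k$ is unimodal if for some index $j$, $a_0\le\cdots\le a_j\ge\cdots\ge a_N$. -}

module Defs where

open import Data.Nat using (ℕ; zero; suc; _+_; _*_; _≤_; _<_; _≡ᵇ_)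
open import Data.Bool using (Bool; true; false; _∧_; _∨_)
open import Data.List using (List; []; _∷_; _++_; map; length; filter; upTo; concatMap)
open import Data.Bool.ListAction using (any; all)
open import Data.Product using (_×_; _,_; ∃-syntax)
open import Relation.Binary.PropositionalEquality using (_≡_)
open import Data.Bool using (T)
open import Relation.Nullary.Decidable using (Dec)
open import Data.Bool.Properties using (T?)

-- A finite simple graph: vertex set {0, …, order-1}, given by a list of
-- (undirected) edges.
record Graph : Set where
  constructor graph
  field
    order : ℕ
    edges : List (ℕ × ℕ)
open Graph public

adj : Graph → ℕ → ℕ → Bool
adj G v w = any (λ { (a , b) → ((a ≡ᵇ v) ∧ (b ≡ᵇ w)) ∨ ((a ≡ᵇ w) ∧ (b ≡ᵇ v)) }) (edges G)

vertices : Graph → List ℕ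
vertices G = upTo (order G)

subsets : {A : Set} → List A → List (List A)
subsets [] = [] ∷ []
subsets (x ∷ xs) = subsets xs ++ map (x ∷_) (subsets xs)

isTotalDominating : Graph → List ℕ → Bool
isTotalDominating G D = all (λ v → any (λ w → adj G v w) D) (vertices G)

-- d_t(G, i): number of total dominating sets of size i
-- (coefficient of x^i in the total domination polynomial D_t(G,x))
dt : Graph → ℕ → ℕ
dt G i = length (filter (λ D → T? (isTotalDominating G D ∧ (length D ≡ᵇ i)))
                        (subsets (vertices G)))

Unimodal : (N : ℕ) → (ℕ → ℕ) → Set
Unimodal N a = ∃[ j ] (j ≤ N
  × (∀ k → k < j → a k ≤ a (suc k))
  × (∀ k → j ≤ k → k < N → a (suc k) ≤ a k))

-- The total domination polynomial of G has degree at most |V(G)|; its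
-- coefficient sequence is (dt G 0, …, dt G |V(G)|).
TotalDomPolyUnimodal : Graph → Set
TotalDomPolyUnimodal G = Unimodal (order G) (dt G)

-- n-book graph B_n: vertex 0 = u, 1 = v; page i (i < n) has vertices
-- 2+2i and 3+2i, with 4-cycle u — (2+2i) — (3+2i) — v — u.
bookGraph : ℕ → Graph
bookGraph n = graph (2 + 2 * n)
  ((0 , 1) ∷ concatMap (λ i → (0 , 2 + 2 * i) ∷ (2 + 2 * i , 3 + 2 * i) ∷ (3 + 2 * i , 1) ∷ []) (upTo n))

-- generalized friendship graph F_{n,4}: center 0; copy i (i < n) has vertices
-- 1+3i, 2+3i, 3+3i, with 4-cycle 0 — (1+3i) — (2+3i) — (3+3i) — 0.
friendshipGraph4 : ℕ → Graph
friendshipGraph4 n = graph (1 + 3 * n)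
  (concatMap (λ i → (0 , 1 + 3 * i) ∷ (1 + 3 * i , 2 + 3 * i) ∷ (2 + 3 * i , 3 + 3 * i) ∷ (3 + 3 * i , 0) ∷ []) (upTo n))

-- Both graphs are n gadgets (4-cycles) glued at hub vertices, so a set is totally dominating exactly
-- when every gadget is dominated given the choice made at the hubs (for n ≥ 1 the hubs are then
-- dominated automatically). Splitting by the hubs and counting gadget by gadget gives
--   D_t(B_n, x)     = x^(2n) + 2 x^(n+1) (1 + x)^n + x^2 (1 + x)^(2n),
--   D_t(F_{n,4}, x) = x^(n+1) (2 + x)^n ((1 + x)^n + x^(n-1)).
-- The coefficients of (1 + x)^n + x^(n-1) are log-concave without internal zeros, multiplying by 2 + x
-- or by x preserves this, and such sequences are unimodal. The book polynomial rises up to x^(n+2) and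
-- then falls, since C(2n, n+m) - C(2n, n+m+1) exceeds 2 C(n, m+2) once n ≥ 8; the cases n ≤ 7 and the
-- degenerate graphs for n = 0 are settled by evaluation.

module Submission where

open import Defs
open import Data.Nat using (ℕ)
open import Data.Product using (_×_)

open import Algebra.Bundles using (CommutativeMonoid)
open import Data.Bool using (Bool; true; false; T; _∧_; _∨_; if_then_else_)
open import Data.Bool.ListAction using (and; or; any; all)
open import Data.Bool.Properties
  using (T?; ∧-assoc; ∧-comm; ∧-zeroʳ; ∧-distribˡ-∨; ∧-distribʳ-∨; ∨-assoc; ∨-identityʳ; ∨-commutativeMonoid)
open import Data.Empty using (⊥-elim)
open import Data.List using (List; []; _∷_; _++_; map; length; filter; upTo; applyUpTo; concatMap)
open import Data.List.Properties using (filter-++; filter-≐; length-++; length-map; map-++; map-∘; map-upTo)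
open import Data.Nat hiding (_^_)
open import Data.Nat.Combinatorics using (_C_; nCk+nC[k+1]≡[n+1]C[k+1]; k>n⇒nCk≡0; nC1≡n; nCn≡1; nCk≡nC[n∸k])
open import Data.Nat.DivMod using (_%_; [m+kn]%n≡m%n; m*n%n≡0; m<n⇒m%n≡m)
open import Data.Nat.Properties
open import Data.Nat.Tactic.RingSolver using (solve-∀; solve)
open import Data.Product using (_,_; proj₁; proj₂; ∃-syntax)
open import Data.Sum using (_⊎_; inj₁; inj₂)
open import Function using (_∘_)
open import Relation.Binary.PropositionalEquality
open import Relation.Nullary using (yes; no)
open import Relation.Nullary.Decidable using (Dec; True; toWitness; map′; _×-dec_; _→-dec_)

open import Algebra.Properties.CommutativeSemigroup *-commutativeSemigroup using (interchange)
open import Algebra.Properties.CommutativeSemigroup (CommutativeMonoid.commutativeSemigroup ∨-commutativeMonoid)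
  using () renaming (interchange to ∨-interchange)

-- Polynomials with natural coefficients, as coefficient sequences (shift multiplies by x)

Poly : Set
Poly = ℕ → ℕ

open import Function.Endo.Propositional Poly using (_^_)

infixl 6 _⊕_

_⊕_ : Poly → Poly → Poly
(f ⊕ g) k = f k + g k

shift : Poly → Poly
shift f zero    = 0
shift f (suc k) = f k

mulLinear : ℕ → ℕ → Poly → Poly
mulLinear c d f k = c * f k + d * shift f k

onePlusX : Poly → Poly
onePlusX f = f ⊕ shift f

twoPlusX : Poly → Poly
twoPlusX = mulLinear 2 1

monomial : ℕ → Poly
monomial p k = if p ≡ᵇ k then 1 else 0

Congruent : (Poly → Poly) → Set
Congruent F = ∀ {f g} → f ≗ g → F f ≗ F g

⊕-cong : ∀ {f f′ g g′} → f ≗ f′ → g ≗ g′ → f ⊕ g ≗ f′ ⊕ g′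
⊕-cong f≗f′ g≗g′ k = cong₂ _+_ (f≗f′ k) (g≗g′ k)

shift-cong : Congruent shift
shift-cong f≗g zero    = refl
shift-cong f≗g (suc k) = f≗g k

onePlusX-cong : Congruent onePlusX
onePlusX-cong f≗g = ⊕-cong f≗g (shift-cong f≗g)

twoPlusX-cong : Congruent twoPlusX
twoPlusX-cong f≗g k = cong₂ (λ x y → 2 * x + 1 * y) (f≗g k) (shift-cong f≗g k)

shift-⊕ : ∀ f g → shift (f ⊕ g) ≗ shift f ⊕ shift g
shift-⊕ f g zero    = refl
shift-⊕ f g (suc k) = refl

twoPlusX-⊕ : ∀ f g → twoPlusX (f ⊕ g) ≗ twoPlusX f ⊕ twoPlusX g
twoPlusX-⊕ f g k = trans (cong (λ x → 2 * (f k + g k) + 1 * x) (shift-⊕ f g k)) (distrib (f k) (g k) (shift f k) (shift g k))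
  where
    distrib : ∀ a b c d → 2 * (a + b) + 1 * (c + d) ≡ (2 * a + 1 * c) + (2 * b + 1 * d)
    distrib = solve-∀

onePlusX-shift : ∀ f → onePlusX (shift f) ≗ shift (onePlusX f)
onePlusX-shift f zero    = refl
onePlusX-shift f (suc k) = refl

twoPlusX-shift : ∀ f → twoPlusX (shift f) ≗ shift (twoPlusX f)
twoPlusX-shift f zero    = refl
twoPlusX-shift f (suc k) = refl

shift-twoPlusX : ∀ f → shift (twoPlusX f) ≗ twoPlusX (shift f)
shift-twoPlusX f k = sym (twoPlusX-shift f k)

twoPlusX-onePlusX : ∀ f → twoPlusX (onePlusX f) ≗ onePlusX (twoPlusX f)
twoPlusX-onePlusX f zero    = distrib (f 0)
  where
    distrib : ∀ a → 2 * (a + 0) + 1 * 0 ≡ (2 * a + 1 * 0) + 0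
    distrib = solve-∀
twoPlusX-onePlusX f (suc k) = distrib (f (suc k)) (f k) (shift f k)
  where
    distrib : ∀ a b c → 2 * (a + b) + 1 * (b + c) ≡ (2 * a + 1 * b) + (2 * b + 1 * c)
    distrib = solve-∀

mulLinear-1-1 : ∀ f → mulLinear 1 1 f ≗ onePlusX f
mulLinear-1-1 f k = cong₂ _+_ (*-identityˡ (f k)) (*-identityˡ (shift f k))

shift-monomial : ∀ p → shift (monomial p) ≗ monomial (suc p)
shift-monomial p zero    = refl
shift-monomial p (suc k) = refl

monomial-diag : ∀ p → monomial p p ≡ 1
monomial-diag zero    = refl
monomial-diag (suc p) = monomial-diag p

≡ᵇ-refl : ∀ n → (n ≡ᵇ n) ≡ true
≡ᵇ-refl zero    = refl
≡ᵇ-refl (suc n) = ≡ᵇ-refl n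

≡ᵇ-false : ∀ {m n} → m ≢ n → (m ≡ᵇ n) ≡ false
≡ᵇ-false {zero}  {zero}  m≢n = ⊥-elim (m≢n refl)
≡ᵇ-false {zero}  {suc n} _   = refl
≡ᵇ-false {suc m} {zero}  _   = refl
≡ᵇ-false {suc m} {suc n} m≢n = ≡ᵇ-false (m≢n ∘ cong suc)

monomial-off : ∀ {p k} → p ≢ k → monomial p k ≡ 0
monomial-off p≢k = cong (λ b → if b then 1 else 0) (≡ᵇ-false p≢k)

monomial-≤1 : ∀ p k → monomial p k ≤ 1
monomial-≤1 p k with p ≡ᵇ k
... | true  = ≤-refl
... | false = z≤n

module _ {F : Poly → Poly} (F-cong : Congruent F) where

  ^-cong : ∀ i → Congruent (F ^ i)
  ^-cong zero    f≗g = f≗g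
  ^-cong (suc i) f≗g = F-cong (^-cong i f≗g)

  ^-commute : ∀ {G : Poly → Poly} → (∀ f → F (G f) ≗ G (F f)) → ∀ i f → (F ^ i) (G f) ≗ G ((F ^ i) f)
  ^-commute     FG zero    f k = refl
  ^-commute {G} FG (suc i) f k = trans (F-cong (^-commute {G} FG i f) k) (FG _ k)

  ^-distrib-⊕ : (∀ f g → F (f ⊕ g) ≗ F f ⊕ F g) → ∀ i f g → (F ^ i) (f ⊕ g) ≗ (F ^ i) f ⊕ (F ^ i) g
  ^-distrib-⊕ F-⊕ zero    f g k = refl
  ^-distrib-⊕ F-⊕ (suc i) f g k = trans (F-cong (^-distrib-⊕ F-⊕ i f g) k) (F-⊕ _ _ k)

shift^-at : ∀ j f k → (shift ^ j) f (j + k) ≡ f k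
shift^-at zero    f k = refl
shift^-at (suc j) f k = shift^-at j f k

-- Log-concavity and unimodality

LogConcave : Poly → Set
LogConcave f = ∀ k → f k * f (2 + k) ≤ f (1 + k) * f (1 + k)

record Support (f : Poly) (lo hi : ℕ) : Set where
  field
    lo≤hi      : lo ≤ hi
    positive   : ∀ {k} → lo ≤ k → k ≤ hi → 0 < f k
    zero-below : ∀ {k} → k < lo → f k ≡ 0
    zero-above : ∀ {k} → hi < k → f k ≡ 0

LogConcaveOn : Poly → ℕ → ℕ → Set
LogConcaveOn f lo hi = LogConcave f × Support f lo hi

Rising : Poly → ℕ → Set
Rising f j = ∀ k → k < j → f k ≤ f (suc k)

Falling : Poly → ℕ → ℕ → Set
Falling f j N = ∀ k → j ≤ k → k < N → f (suc k) ≤ f k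

Unimodal-resp-≗ : ∀ {f g} N → f ≗ g → Unimodal N f → Unimodal N g
Unimodal-resp-≗ N f≗g (j , j≤N , rising , falling) =
  j , j≤N , (λ k k<j → subst₂ _≤_ (f≗g k) (f≗g (suc k)) (rising k k<j))
          , (λ k j≤k k<N → subst₂ _≤_ (f≗g (suc k)) (f≗g k) (falling k j≤k k<N))

LogConcave-resp-≗ : ∀ {f g} → f ≗ g → LogConcave f → LogConcave g
LogConcave-resp-≗ f≗g lc k =
  subst₂ _≤_ (cong₂ _*_ (f≗g k) (f≗g (2 + k))) (cong₂ _*_ (f≗g (1 + k)) (f≗g (1 + k))) (lc k)

logConcave-shift : ∀ {f} → LogConcave f → LogConcave (shift f)
logConcave-shift lc zero    = z≤n
logConcave-shift lc (suc k) = lc k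

support-shift : ∀ {f lo hi} → Support f lo hi → Support (shift f) (suc lo) (suc hi)
support-shift supp = record
  { lo≤hi      = s≤s lo≤hi
  ; positive   = λ { {suc k} lo<k k≤hi → positive (s≤s⁻¹ lo<k) (s≤s⁻¹ k≤hi) }
  ; zero-below = λ { {zero} _ → refl ; {suc k} k<lo → zero-below (s≤s⁻¹ k<lo) }
  ; zero-above = λ { {suc k} hi<k → zero-above (s≤s⁻¹ hi<k) }
  }
  where open Support supp

logConcave-cross : ∀ {f lo hi} → LogConcave f → Support f lo hi → ∀ j → f j * f (3 + j) ≤ f (1 + j) * f (2 + j)
logConcave-cross {f} {lo} {hi} lc supp j with lo ≤? j | 3 + j ≤? hi
... | no j≱lo | _ rewrite Support.zero-below supp (≰⇒> j≱lo) = z≤n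
... | yes _ | no j+3≰hi rewrite Support.zero-above supp (≰⇒> j+3≰hi) | *-zeroʳ (f j) = z≤n
... | yes lo≤j | yes j+3≤hi = *-cancelˡ-≤ (b * c) {{>-nonZero (*-mono-< 0<b 0<c)}} (begin
    (b * c) * (a * d) ≡⟨ rearrange a b c d ⟩
    (a * c) * (b * d) ≤⟨ *-mono-≤ (lc j) (lc (suc j)) ⟩
    (b * b) * (c * c) ≡⟨ interchange b b c c ⟩
    (b * c) * (b * c) ∎)
  where
    open Support supp using (positive)
    open ≤-Reasoning
    rearrange : ∀ a b c d → (b * c) * (a * d) ≡ (a * c) * (b * d)
    rearrange = solve-∀
    a b c d : ℕ
    a = f j
    b = f (1 + j)
    c = f (2 + j)
    d = f (3 + j)
    0<b : 0 < b
    0<b = positive (m≤n⇒m≤1+n lo≤j) (≤-trans (n≤1+n (1 + j)) (≤-trans (n≤1+n (2 + j)) j+3≤hi))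
    0<c : 0 < c
    0<c = positive (m≤n⇒m≤1+n (m≤n⇒m≤1+n lo≤j)) (≤-trans (n≤1+n (2 + j)) j+3≤hi)

-- The middle cross term is bounded by applying the cross inequality to shift f.
logConcave-mulLinear : ∀ {f lo hi} c d → LogConcave f → Support f lo hi → LogConcave (mulLinear c d f)
logConcave-mulLinear {f} c d lc supp k = begin
  (c * f₀ + d * s) * (c * f₂ + d * f₁)
    ≡⟨ expand-left c d f₀ f₁ f₂ s ⟩
  c * c * (f₀ * f₂) + c * d * (f₀ * f₁) + (c * d * (s * f₂) + d * d * (s * f₁))
    ≤⟨ +-mono-≤ (+-monoˡ-≤ _ (*-monoʳ-≤ (c * c) (lc k)))
                (+-mono-≤ (*-monoʳ-≤ (c * d) (logConcave-cross (logConcave-shift lc) (support-shift supp) k))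
                          (*-monoʳ-≤ (d * d) (logConcave-shift lc k))) ⟩
  c * c * (f₁ * f₁) + c * d * (f₀ * f₁) + (c * d * (f₀ * f₁) + d * d * (f₀ * f₀))
    ≡⟨ expand-right c d f₀ f₁ ⟨
  (c * f₁ + d * f₀) * (c * f₁ + d * f₀) ∎
  where
    open ≤-Reasoning
    s f₀ f₁ f₂ : ℕ
    s = shift f k
    f₀ = f k
    f₁ = f (1 + k)
    f₂ = f (2 + k)
    expand-left : ∀ c d f₀ f₁ f₂ s → (c * f₀ + d * s) * (c * f₂ + d * f₁)
      ≡ c * c * (f₀ * f₂) + c * d * (f₀ * f₁) + (c * d * (s * f₂) + d * d * (s * f₁))
    expand-left = solve-∀
    expand-right : ∀ c d f₀ f₁ → (c * f₁ + d * f₀) * (c * f₁ + d * f₀)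
      ≡ c * c * (f₁ * f₁) + c * d * (f₀ * f₁) + (c * d * (f₀ * f₁) + d * d * (f₀ * f₀))
    expand-right = solve-∀

support-mulLinear : ∀ {f lo hi c d} → 0 < c → 0 < d → Support f lo hi → Support (mulLinear c d f) lo (suc hi)
support-mulLinear {f} {lo} {hi} {c} {d} 0<c 0<d supp = record
  { lo≤hi      = m≤n⇒m≤1+n lo≤hi
  ; positive   = positive′
  ; zero-below = zero-below′
  ; zero-above = zero-above′
  }
  where
    open Support supp
    positive′ : ∀ {k} → lo ≤ k → k ≤ suc hi → 0 < c * f k + d * shift f k
    positive′ {k} lo≤k k≤1+hi with k ≤? hi
    ... | yes k≤hi = ≤-trans (*-mono-≤ 0<c (positive lo≤k k≤hi)) (m≤m+n (c * f k) _)
    positive′ {zero}  _ _      | no k≰hi = ⊥-elim (k≰hi z≤n)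
    positive′ {suc k} _ k<1+hi | no k≰hi =
      ≤-trans (*-mono-≤ 0<d (positive (≤-trans lo≤hi (s≤s⁻¹ (≰⇒> k≰hi))) (s≤s⁻¹ k<1+hi))) (m≤n+m (d * f k) _)
    zero-below′ : ∀ {k} → k < lo → c * f k + d * shift f k ≡ 0
    zero-below′ {zero}  k<lo rewrite zero-below k<lo | *-zeroʳ c = *-zeroʳ d
    zero-below′ {suc k} k<lo rewrite zero-below k<lo | zero-below (<-trans (n<1+n k) k<lo) | *-zeroʳ c = *-zeroʳ d
    zero-above′ : ∀ {k} → suc hi < k → c * f k + d * shift f k ≡ 0
    zero-above′ {suc k} hi<k rewrite zero-above (m<n⇒m<1+n (s≤s⁻¹ hi<k)) | zero-above (s≤s⁻¹ hi<k) | *-zeroʳ c = *-zeroʳ d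

logConcave-mulLinear^ : ∀ {c d} → 0 < c → 0 < d → ∀ i {f lo hi} →
                        LogConcaveOn f lo hi → LogConcaveOn ((mulLinear c d ^ i) f) lo (i + hi)
logConcave-mulLinear^             0<c 0<d zero    lc = lc
logConcave-mulLinear^ {c} {d} 0<c 0<d (suc i) lc with logConcave-mulLinear^ 0<c 0<d i lc
... | lc′ , supp′ = logConcave-mulLinear c d lc′ supp′ , support-mulLinear 0<c 0<d supp′

logConcave-shift^ : ∀ j {f lo hi} → LogConcaveOn f lo hi → LogConcaveOn ((shift ^ j) f) (j + lo) (j + hi)
logConcave-shift^ zero    lc = lc
logConcave-shift^ (suc j) lc with logConcave-shift^ j lc
... | lc′ , supp′ = logConcave-shift lc′ , support-shift supp′

module _ {f : Poly} {lo hi : ℕ} (lc : LogConcave f) (supp : Support f lo hi) where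
  open Support supp

  private
    descent-persists : ∀ {k} → lo ≤ k → f (suc k) ≤ f k → f (2 + k) ≤ f (1 + k)
    descent-persists {k} lo≤k fall with f (suc k) in eq
    ... | zero with suc k ≤? hi
    ...   | yes 1+k≤hi = ⊥-elim (n≮0 (subst (0 <_) eq (positive (m≤n⇒m≤1+n lo≤k) 1+k≤hi)))
    ...   | no 1+k≰hi = ≤-reflexive (zero-above (m<n⇒m<1+n (≰⇒> 1+k≰hi)))
    descent-persists {k} lo≤k fall | suc m = *-cancelˡ-≤ (suc m) (begin
      suc m * f (2 + k)     ≤⟨ *-monoˡ-≤ (f (2 + k)) fall ⟩
      f k * f (2 + k)       ≤⟨ lc k ⟩
      f (1 + k) * f (1 + k) ≡⟨ cong (λ x → x * x) eq ⟩
      suc m * suc m         ∎)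
      where open ≤-Reasoning

    falling-extend : ∀ {j N} → lo ≤ j → j < N → Falling f j N → Falling f j (suc N)
    falling-extend lo≤j j<N falling k j≤k k<1+N with m<1+n⇒m<n∨m≡n k<1+N
    ... | inj₁ k<N = falling k j≤k k<N
    falling-extend {N = suc N} lo≤j (s≤s j≤N) falling _ _ _ | inj₂ refl =
      descent-persists (≤-trans lo≤j j≤N) (falling N j≤N ≤-refl)

    -- A peak that is not the last index is followed by a strict drop; this keeps it inside the
    -- support, where log-concavity propagates the descent.
    peak : ∀ N → ∃[ j ] (j ≤ N × Rising f j × Falling f j N × (j < N → f (suc j) < f j))
    peak zero = 0 , z≤n , (λ _ ()) , (λ _ _ ()) , λ ()
    peak (suc N) with peak N
    ... | j , j≤N , rising , falling , drop with m≤n⇒m<n∨m≡n j≤N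
    ...   | inj₁ j<N = j , m≤n⇒m≤1+n j≤N , rising , falling-extend lo≤j j<N falling , λ _ → drop j<N
      where
        lo≤j : lo ≤ j
        lo≤j = ≮⇒≥ (λ j<lo → n≮0 (subst (f (suc j) <_) (zero-below j<lo) (drop j<N)))
    ...   | inj₂ refl with f (suc j) <? f j
    ...     | yes fall = j , n≤1+n j , rising , falling′ , λ _ → fall
      where
        falling′ : Falling f j (suc j)
        falling′ k j≤k k<1+j with ≤-antisym j≤k (s≤s⁻¹ k<1+j)
        ... | refl = <⇒≤ fall
    ...     | no rise = suc j , ≤-refl , rising′ , (λ k 1+j≤k k<1+j → ⊥-elim (n≮n k (≤-trans k<1+j 1+j≤k)))
                                                   , λ j<j → ⊥-elim (n≮n (suc j) j<j)
      where
        rising′ : Rising f (suc j)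
        rising′ k k<1+j with m<1+n⇒m<n∨m≡n k<1+j
        ... | inj₁ k<j = rising k k<j
        ... | inj₂ refl = ≮⇒≥ rise

  logConcave⇒unimodal : ∀ N → Unimodal N f
  logConcave⇒unimodal N with peak N
  ... | j , j≤N , rising , falling , _ = j , j≤N , rising , falling

Rising-⊕ : ∀ {f g j} → Rising f j → Rising g j → Rising (f ⊕ g) j
Rising-⊕ rf rg k k<j = +-mono-≤ (rf k k<j) (rg k k<j)

Rising-≤ : ∀ {f j j′} → j′ ≤ j → Rising f j → Rising f j′
Rising-≤ j′≤j rf k k<j′ = rf k (≤-trans k<j′ j′≤j)

Rising-shift^ : ∀ {f j} i → Rising f j → Rising ((shift ^ i) f) (i + j)
Rising-shift^ zero    rf = rf
Rising-shift^ (suc i) rf zero    _         = z≤n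
Rising-shift^ (suc i) rf (suc k) (s≤s k<j) = Rising-shift^ i rf k k<j

rising? : ∀ f j → Dec (Rising f j)
rising? f j = map′ (λ r k → r {k}) (λ r {k} → r k) (allUpTo? (λ k → f k ≤? f (suc k)) j)

falling? : ∀ f j N → Dec (Falling f j N)
falling? f j N = map′ (λ r k j≤k k<N → r k<N j≤k) (λ r {k} k<N j≤k → r k j≤k k<N)
                      (allUpTo? (λ k → j ≤? k →-dec f (suc k) ≤? f k) N)

unimodal-with-peak : ∀ {N} f j → True (j ≤? N ×-dec rising? f j ×-dec falling? f j N) → Unimodal N f
unimodal-with-peak f j checked = j , toWitness checked

binomial : ℕ → Poly
binomial n k = n C k

[1+n]C[1+k]≡nCk+nC[1+k] : ∀ n k → suc n C suc k ≡ n C k + n C suc k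
[1+n]C[1+k]≡nCk+nC[1+k] n k = sym (nCk+nC[k+1]≡[n+1]C[k+1] n k)

nCk>0 : ∀ {n k} → k ≤ n → 0 < n C k
nCk>0 {n}     {zero}  _         = s≤s z≤n
nCk>0 {suc n} {suc k} (s≤s k≤n) =
  subst (0 <_) (sym ([1+n]C[1+k]≡nCk+nC[1+k] n k)) (≤-trans (nCk>0 k≤n) (m≤m+n _ _))

[r+k]Ck≡[r+k]Cr : ∀ r k → (r + k) C k ≡ (r + k) C r
[r+k]Ck≡[r+k]Cr r k = trans (nCk≡nC[n∸k] (m≤n+m k r)) (cong ((r + k) C_) (m+n∸n≡m r k))

binomial-suc : ∀ n → binomial (suc n) ≗ onePlusX (binomial n)
binomial-suc n zero    = refl
binomial-suc n (suc k) = trans ([1+n]C[1+k]≡nCk+nC[1+k] n k) (+-comm (n C k) _)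

support-binomial : ∀ n → Support (binomial n) 0 n
support-binomial n = record
  { lo≤hi      = z≤n
  ; positive   = λ _ → nCk>0
  ; zero-below = λ ()
  ; zero-above = k>n⇒nCk≡0
  }

logConcave-binomial : ∀ n → LogConcave (binomial n)
logConcave-binomial zero    k = ≤-trans (≤-reflexive (*-zeroʳ (0 C k))) z≤n
logConcave-binomial (suc n) = LogConcave-resp-≗ (λ k → trans (mulLinear-1-1 (binomial n) k) (sym (binomial-suc n k)))
  (logConcave-mulLinear 1 1 (logConcave-binomial n) (support-binomial n))

2*[1+n]C2≡[1+n]*n : ∀ n → 2 * (suc n C 2) ≡ suc n * n
2*[1+n]C2≡[1+n]*n zero    = refl
2*[1+n]C2≡[1+n]*n (suc n) = begin
  2 * (suc (suc n) C 2)             ≡⟨ cong (2 *_) ([1+n]C[1+k]≡nCk+nC[1+k] (suc n) 1) ⟩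
  2 * (suc n C 1 + suc n C 2)       ≡⟨ *-distribˡ-+ 2 (suc n C 1) _ ⟩
  2 * (suc n C 1) + 2 * (suc n C 2) ≡⟨ cong₂ _+_ (cong (2 *_) (nC1≡n (suc n))) (2*[1+n]C2≡[1+n]*n n) ⟩
  2 * suc n + suc n * n             ≡⟨ solve (n ∷ []) ⟩
  suc (suc n) * suc n               ∎
  where open ≡-Reasoning

6*[2+n]C3≡[2+n]*[1+n]*n : ∀ n → 6 * (suc (suc n) C 3) ≡ suc (suc n) * suc n * n
6*[2+n]C3≡[2+n]*[1+n]*n zero    = refl
6*[2+n]C3≡[2+n]*[1+n]*n (suc n) = begin
  6 * ((3 + n) C 3)                               ≡⟨ cong (6 *_) ([1+n]C[1+k]≡nCk+nC[1+k] (2 + n) 2) ⟩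
  6 * ((2 + n) C 2 + (2 + n) C 3)                 ≡⟨ *-distribˡ-+ 6 ((2 + n) C 2) _ ⟩
  6 * ((2 + n) C 2) + 6 * ((2 + n) C 3)           ≡⟨ cong₂ _+_ (*-assoc 3 2 ((2 + n) C 2)) (6*[2+n]C3≡[2+n]*[1+n]*n n) ⟩
  3 * (2 * ((2 + n) C 2)) + (2 + n) * (1 + n) * n ≡⟨ cong (λ x → 3 * x + (2 + n) * (1 + n) * n) (2*[1+n]C2≡[1+n]*n (suc n)) ⟩
  3 * ((2 + n) * (1 + n)) + (2 + n) * (1 + n) * n ≡⟨ solve (n ∷ []) ⟩
  (3 + n) * (2 + n) * (1 + n)                     ∎
  where open ≡-Reasoning

nC3*[1+n]≤nC2² : ∀ n → (n C 3) * suc n ≤ (n C 2) * (n C 2)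
nC3*[1+n]≤nC2² zero          = z≤n
nC3*[1+n]≤nC2² (suc zero)    = z≤n
nC3*[1+n]≤nC2² (suc (suc m)) = *-cancelˡ-≤ 36 (begin
  36 * (c₃ * (3 + m))                              ≡⟨ split-36 c₃ m ⟩
  6 * c₃ * (6 * (3 + m))                           ≡⟨ cong (_* (6 * (3 + m))) (6*[2+n]C3≡[2+n]*[1+n]*n m) ⟩
  (2 + m) * (1 + m) * m * (6 * (3 + m))            ≤⟨ m≤m+n _ _ ⟩
  (2 + m) * (1 + m) * m * (6 * (3 + m)) + 3 * ((2 + m) * (1 + m)) * (m * m + 3 * m + 6)
                                                   ≡⟨ solve (m ∷ []) ⟩
  9 * (((2 + m) * (1 + m)) * ((2 + m) * (1 + m)))  ≡⟨ cong (λ x → 9 * (x * x)) (2*[1+n]C2≡[1+n]*n (suc m)) ⟨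
  9 * ((2 * c₂) * (2 * c₂))                        ≡⟨ square-of-double c₂ ⟩
  36 * (c₂ * c₂)                                   ∎)
  where
    open ≤-Reasoning
    c₂ = (2 + m) C 2
    c₃ = (2 + m) C 3
    split-36 : ∀ c m → 36 * (c * (3 + m)) ≡ 6 * c * (6 * (3 + m))
    split-36 = solve-∀
    square-of-double : ∀ c → 9 * ((2 * c) * (2 * c)) ≡ 36 * (c * c)
    square-of-double = solve-∀

[1+k]*[1+n]C[1+k]≡[1+n]*nCk : ∀ n k → suc k * (suc n C suc k) ≡ suc n * (n C k)
[1+k]*[1+n]C[1+k]≡[1+n]*nCk zero    zero    = refl
[1+k]*[1+n]C[1+k]≡[1+n]*nCk zero    (suc k) = *-zeroʳ (2 + k)
[1+k]*[1+n]C[1+k]≡[1+n]*nCk (suc n) zero    =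
  trans (*-identityˡ ((2 + n) C 1)) (trans (nC1≡n (2 + n)) (sym (*-identityʳ (2 + n))))
[1+k]*[1+n]C[1+k]≡[1+n]*nCk (suc n) (suc k) = begin
  (2 + k) * ((2 + n) C (2 + k))
    ≡⟨ cong ((2 + k) *_) ([1+n]C[1+k]≡nCk+nC[1+k] (1 + n) (1 + k)) ⟩
  (2 + k) * ((1 + n) C (1 + k) + (1 + n) C (2 + k))
    ≡⟨ *-distribˡ-+ (2 + k) ((1 + n) C (1 + k)) _ ⟩
  (1 + n) C (1 + k) + (1 + k) * ((1 + n) C (1 + k)) + (2 + k) * ((1 + n) C (2 + k))
    ≡⟨ cong₂ (λ x y → (1 + n) C (1 + k) + x + y) ([1+k]*[1+n]C[1+k]≡[1+n]*nCk n k) ([1+k]*[1+n]C[1+k]≡[1+n]*nCk n (suc k)) ⟩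
  (1 + n) C (1 + k) + (1 + n) * (n C k) + (1 + n) * (n C (1 + k))
    ≡⟨ +-assoc ((1 + n) C (1 + k)) _ _ ⟩
  (1 + n) C (1 + k) + ((1 + n) * (n C k) + (1 + n) * (n C (1 + k)))
    ≡⟨ cong ((1 + n) C (1 + k) +_) (*-distribˡ-+ (1 + n) (n C k) _) ⟨
  (1 + n) C (1 + k) + (1 + n) * (n C k + n C (1 + k))
    ≡⟨ cong (λ x → (1 + n) C (1 + k) + (1 + n) * x) ([1+n]C[1+k]≡nCk+nC[1+k] n k) ⟨
  (2 + n) * ((1 + n) C (1 + k)) ∎
  where open ≡-Reasoning

[1+k]*nC[1+k]+[1+k]*nCk≡[1+n]*nCk : ∀ n k → suc k * (n C suc k) + suc k * (n C k) ≡ suc n * (n C k)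
[1+k]*nC[1+k]+[1+k]*nCk≡[1+n]*nCk n k = begin
  suc k * (n C suc k) + suc k * (n C k) ≡⟨ +-comm (suc k * (n C suc k)) _ ⟩
  suc k * (n C k) + suc k * (n C suc k) ≡⟨ *-distribˡ-+ (suc k) (n C k) _ ⟨
  suc k * (n C k + n C suc k)           ≡⟨ cong (suc k *_) ([1+n]C[1+k]≡nCk+nC[1+k] n k) ⟨
  suc k * (suc n C suc k)               ≡⟨ [1+k]*[1+n]C[1+k]≡[1+n]*nCk n k ⟩
  suc n * (n C k)                       ∎
  where open ≡-Reasoning

nCk≤nC[1+k] : ∀ {n k} → 2 * suc k ≤ suc n → n C k ≤ n C suc k
nCk≤nC[1+k] {n} {k} 2[1+k]≤1+n = *-cancelˡ-≤ (suc k) (+-cancelʳ-≤ (suc k * (n C k)) _ _ (begin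
  suc k * (n C k) + suc k * (n C k)     ≡⟨ *-distribʳ-+ (n C k) (suc k) (suc k) ⟨
  (suc k + suc k) * (n C k)             ≡⟨ cong (λ x → (suc k + x) * (n C k)) (+-identityʳ (suc k)) ⟨
  2 * suc k * (n C k)                   ≤⟨ *-monoˡ-≤ (n C k) 2[1+k]≤1+n ⟩
  suc n * (n C k)                       ≡⟨ [1+k]*nC[1+k]+[1+k]*nCk≡[1+n]*nCk n k ⟨
  suc k * (n C suc k) + suc k * (n C k) ∎))
  where open ≤-Reasoning

nCk≤[1+n]Ck : ∀ n k → n C k ≤ suc n C k
nCk≤[1+n]Ck n zero    = ≤-refl
nCk≤[1+n]Ck n (suc k) = subst (n C suc k ≤_) (sym ([1+n]C[1+k]≡nCk+nC[1+k] n k)) (m≤n+m _ _)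

aCr*bCs≤[a+b]C[r+s] : ∀ a b r s → (a C r) * (b C s) ≤ (a + b) C (r + s)
aCr*bCs≤[a+b]C[r+s] zero    b zero    s = ≤-reflexive (+-identityʳ (b C s))
aCr*bCs≤[a+b]C[r+s] zero    b (suc r) s = z≤n
aCr*bCs≤[a+b]C[r+s] (suc a) b zero    s = begin
  1 * (b C s)      ≤⟨ aCr*bCs≤[a+b]C[r+s] a b zero s ⟩
  (a + b) C s      ≤⟨ nCk≤[1+n]Ck (a + b) s ⟩
  suc (a + b) C s  ∎
  where open ≤-Reasoning
aCr*bCs≤[a+b]C[r+s] (suc a) b (suc r) s = begin
  (suc a C suc r) * (b C s)                  ≡⟨ cong (_* (b C s)) ([1+n]C[1+k]≡nCk+nC[1+k] a r) ⟩
  (a C r + a C suc r) * (b C s)              ≡⟨ *-distribʳ-+ (b C s) (a C r) _ ⟩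
  (a C r) * (b C s) + (a C suc r) * (b C s)  ≤⟨ +-mono-≤ (aCr*bCs≤[a+b]C[r+s] a b r s) (aCr*bCs≤[a+b]C[r+s] a b (suc r) s) ⟩
  (a + b) C (r + s) + (a + b) C (suc r + s)  ≡⟨ [1+n]C[1+k]≡nCk+nC[1+k] (a + b) (r + s) ⟨
  suc (a + b) C suc (r + s)                  ∎
  where open ≤-Reasoning

3*[3+t]≤[2+t]Ct : ∀ t → 6 ≤ t → 3 * (3 + t) ≤ (2 + t) C t
3*[3+t]≤[2+t]Ct t 6≤t = *-cancelˡ-≤ 2 (begin
  2 * (3 * (3 + t))                        ≡⟨ cong (λ x → 2 * (3 * (3 + x))) (m+[n∸m]≡n 6≤t) ⟨
  2 * (3 * (9 + u))                        ≤⟨ m≤m+n _ (2 + 9 * u + u * u) ⟩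
  2 * (3 * (9 + u)) + (2 + 9 * u + u * u)  ≡⟨ expand u ⟩
  (8 + u) * (7 + u)                        ≡⟨ cong (λ x → (2 + x) * (1 + x)) (m+[n∸m]≡n 6≤t) ⟩
  (2 + t) * (1 + t)                        ≡⟨ 2*[1+n]C2≡[1+n]*n (suc t) ⟨
  2 * ((2 + t) C 2)                        ≡⟨ cong (2 *_) ([r+k]Ck≡[r+k]Cr 2 t) ⟨
  2 * ((2 + t) C t)                        ∎)
  where
    open ≤-Reasoning
    u = t ∸ 6
    expand : ∀ u → 2 * (3 * (9 + u)) + (2 + 9 * u + u * u) ≡ (8 + u) * (7 + u)
    expand = solve-∀

binomial-rising : ∀ {n j} → 2 * j ≤ suc n → Rising (binomial n) j
binomial-rising 2j≤1+n k k<j = nCk≤nC[1+k] (≤-trans (*-monoʳ-≤ 2 k<j) 2j≤1+n)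

-- Counting dominating sets through characteristic vectors

count : {A : Set} → (A → Bool) → List A → ℕ
count p xs = length (filter (λ x → T? (p x)) xs)

count-++ : ∀ {A : Set} (p : A → Bool) xs ys → count p (xs ++ ys) ≡ count p xs + count p ys
count-++ p xs ys = trans (cong length (filter-++ (T? ∘ p) xs ys)) (length-++ (filter (T? ∘ p) xs))

count-cong : ∀ {A : Set} {p q : A → Bool} → (∀ x → p x ≡ q x) → count p ≗ count q
count-cong {p = p} {q = q} p≗q xs =
  cong length (filter-≐ (T? ∘ p) (T? ∘ q) ((λ {x} → subst T (p≗q x)) , λ {x} → subst T (sym (p≗q x))) xs)

count-false : ∀ {A : Set} (xs : List A) → count (λ _ → false) xs ≡ 0
count-false []       = refl
count-false (x ∷ xs) = count-false xs

count-map : ∀ {A B : Set} (p : B → Bool) (f : A → B) xs → count p (map f xs) ≡ count (p ∘ f) xs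
count-map p f []       = refl
count-map p f (x ∷ xs) with p (f x)
... | true  = cong suc (count-map p f xs)
... | false = count-map p f xs

bitStrings : ℕ → List (List Bool)
bitStrings zero    = [] ∷ []
bitStrings (suc m) = map (false ∷_) (bitStrings m) ++ map (true ∷_) (bitStrings m)

weight : List Bool → ℕ
weight = count (λ b → b)

infix 7 _∈ᵇ_

_∈ᵇ_ : ℕ → List Bool → Bool
v     ∈ᵇ []       = false
zero  ∈ᵇ (b ∷ bs) = b
suc v ∈ᵇ (b ∷ bs) = v ∈ᵇ bs

toSet : List Bool → List ℕ
toSet []           = []
toSet (false ∷ bs) = map suc (toSet bs)
toSet (true ∷ bs)  = 0 ∷ map suc (toSet bs)

subsets-map : ∀ {A B : Set} (f : A → B) xs → subsets (map f xs) ≡ map (map f) (subsets xs)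
subsets-map f []       = refl
subsets-map f (x ∷ xs) = begin
  subsets (map f xs) ++ map (f x ∷_) (subsets (map f xs))
    ≡⟨ cong (λ S → S ++ map (f x ∷_) S) (subsets-map f xs) ⟩
  map (map f) S ++ map (f x ∷_) (map (map f) S)
    ≡⟨ cong (map (map f) S ++_) (trans (sym (map-∘ S)) (map-∘ S)) ⟩
  map (map f) S ++ map (map f) (map (x ∷_) S)
    ≡⟨ map-++ (map f) S (map (x ∷_) S) ⟨
  map (map f) (S ++ map (x ∷_) S) ∎
  where
    open ≡-Reasoning
    S = subsets xs

subsets-upTo : ∀ m → subsets (upTo m) ≡ map toSet (bitStrings m)
subsets-upTo zero    = refl
subsets-upTo (suc m) = begin
  subsets (applyUpTo suc m) ++ map (0 ∷_) (subsets (applyUpTo suc m))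
    ≡⟨ cong (λ S → S ++ map (0 ∷_) S) shifted ⟩
  map (map suc ∘ toSet) Bs ++ map (0 ∷_) (map (map suc ∘ toSet) Bs)
    ≡⟨ cong₂ _++_ (map-∘ Bs) (trans (sym (map-∘ Bs)) (map-∘ Bs)) ⟩
  map toSet (map (false ∷_) Bs) ++ map toSet (map (true ∷_) Bs)
    ≡⟨ map-++ toSet (map (false ∷_) Bs) _ ⟨
  map toSet (bitStrings (suc m)) ∎
  where
    open ≡-Reasoning
    Bs = bitStrings m
    shifted : subsets (applyUpTo suc m) ≡ map (map suc ∘ toSet) Bs
    shifted = begin
      subsets (applyUpTo suc m)          ≡⟨ cong subsets (map-upTo suc m) ⟨
      subsets (map suc (upTo m))         ≡⟨ subsets-map suc (upTo m) ⟩
      map (map suc) (subsets (upTo m))   ≡⟨ cong (map (map suc)) (subsets-upTo m) ⟩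
      map (map suc) (map toSet Bs)       ≡⟨ map-∘ Bs ⟨
      map (map suc ∘ toSet) Bs           ∎

length-toSet : ∀ bs → length (toSet bs) ≡ weight bs
length-toSet []           = refl
length-toSet (false ∷ bs) = trans (length-map suc (toSet bs)) (length-toSet bs)
length-toSet (true ∷ bs)  = cong suc (trans (length-map suc (toSet bs)) (length-toSet bs))

elem : ℕ → List ℕ → Bool
elem x = any (x ≡ᵇ_)

elem-zero-map-suc : ∀ xs → elem 0 (map suc xs) ≡ false
elem-zero-map-suc []       = refl
elem-zero-map-suc (_ ∷ xs) = elem-zero-map-suc xs

elem-suc-map-suc : ∀ x xs → elem (suc x) (map suc xs) ≡ elem x xs
elem-suc-map-suc x []       = refl
elem-suc-map-suc x (y ∷ xs) = cong ((x ≡ᵇ y) ∨_) (elem-suc-map-suc x xs)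

elem-toSet : ∀ x bs → elem x (toSet bs) ≡ x ∈ᵇ bs
elem-toSet x       []           = refl
elem-toSet zero    (false ∷ bs) = elem-zero-map-suc (toSet bs)
elem-toSet zero    (true ∷ bs)  = refl
elem-toSet (suc x) (false ∷ bs) = trans (elem-suc-map-suc x (toSet bs)) (elem-toSet x bs)
elem-toSet (suc x) (true ∷ bs)  = trans (elem-suc-map-suc x (toSet bs)) (elem-toSet x bs)

countBits : (List Bool → Bool) → ℕ → Poly
countBits Φ m k = count (λ bs → Φ bs ∧ (weight bs ≡ᵇ k)) (bitStrings m)

countBits-cong : ∀ {Φ Ψ} → (∀ bs → Φ bs ≡ Ψ bs) → ∀ m → countBits Φ m ≗ countBits Ψ m
countBits-cong Φ≗Ψ m k = count-cong (λ bs → cong (_∧ (weight bs ≡ᵇ k)) (Φ≗Ψ bs)) (bitStrings m)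

countBits-false : ∀ m k → countBits (λ _ → false) m k ≡ 0
countBits-false m k = count-false (bitStrings m)

countBits-suc : ∀ Φ m → countBits Φ (suc m) ≗ countBits (Φ ∘ (false ∷_)) m ⊕ shift (countBits (Φ ∘ (true ∷_)) m)
countBits-suc Φ m k = begin
  countBits Φ (suc m) k
    ≡⟨ count-++ _ (map (false ∷_) (bitStrings m)) _ ⟩
  count _ (map (false ∷_) (bitStrings m)) + count _ (map (true ∷_) (bitStrings m))
    ≡⟨ cong₂ _+_ (count-map _ (false ∷_) (bitStrings m)) (count-map _ (true ∷_) (bitStrings m)) ⟩
  countBits (Φ ∘ (false ∷_)) m k + count (λ bs → Φ (true ∷ bs) ∧ (suc (weight bs) ≡ᵇ k)) (bitStrings m)
    ≡⟨ cong (countBits (Φ ∘ (false ∷_)) m k +_) (with-true k) ⟩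
  countBits (Φ ∘ (false ∷_)) m k + shift (countBits (Φ ∘ (true ∷_)) m) k ∎
  where
    open ≡-Reasoning
    with-true : ∀ k → count (λ bs → Φ (true ∷ bs) ∧ (suc (weight bs) ≡ᵇ k)) (bitStrings m)
                    ≡ shift (countBits (Φ ∘ (true ∷_)) m) k
    with-true zero    = trans (count-cong (λ bs → ∧-zeroʳ (Φ (true ∷ bs))) (bitStrings m)) (count-false (bitStrings m))
    with-true (suc k) = refl

countBits-cons₂ : ∀ Φ m → countBits Φ (2 + m) ≗
  countBits (λ ps → Φ (false ∷ false ∷ ps)) m ⊕ shift (countBits (λ ps → Φ (false ∷ true ∷ ps)) m)
  ⊕ shift (countBits (λ ps → Φ (true ∷ false ∷ ps)) m ⊕ shift (countBits (λ ps → Φ (true ∷ true ∷ ps)) m))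
countBits-cons₂ Φ m k = trans (countBits-suc Φ (suc m) k)
  (cong₂ _+_ (countBits-suc (Φ ∘ (false ∷_)) m k) (shift-cong (countBits-suc (Φ ∘ (true ∷_)) m) k))

countBits-cons₃ : ∀ Φ m → countBits Φ (3 + m) ≗
  (countBits (λ ps → Φ (false ∷ false ∷ false ∷ ps)) m ⊕ shift (countBits (λ ps → Φ (false ∷ false ∷ true ∷ ps)) m)
   ⊕ shift (countBits (λ ps → Φ (false ∷ true ∷ false ∷ ps)) m ⊕ shift (countBits (λ ps → Φ (false ∷ true ∷ true ∷ ps)) m)))
  ⊕ shift (countBits (λ ps → Φ (true ∷ false ∷ false ∷ ps)) m ⊕ shift (countBits (λ ps → Φ (true ∷ false ∷ true ∷ ps)) m)
   ⊕ shift (countBits (λ ps → Φ (true ∷ true ∷ false ∷ ps)) m ⊕ shift (countBits (λ ps → Φ (true ∷ true ∷ true ∷ ps)) m)))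
countBits-cons₃ Φ m k = trans (countBits-suc Φ (2 + m) k)
  (cong₂ _+_ (countBits-cons₂ (Φ ∘ (false ∷_)) m k) (shift-cong (countBits-cons₂ (Φ ∘ (true ∷_)) m) k))

any-cong : ∀ {A : Set} {p q : A → Bool} → (∀ x → p x ≡ q x) → any p ≗ any q
any-cong p≗q []       = refl
any-cong p≗q (x ∷ xs) = cong₂ _∨_ (p≗q x) (any-cong p≗q xs)

all-cong : ∀ {A : Set} {p q : A → Bool} → (∀ x → p x ≡ q x) → all p ≗ all q
all-cong p≗q []       = refl
all-cong p≗q (x ∷ xs) = cong₂ _∧_ (p≗q x) (all-cong p≗q xs)

any-++ : ∀ {A : Set} (p : A → Bool) xs ys → any p (xs ++ ys) ≡ any p xs ∨ any p ys
any-++ p []       ys = refl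
any-++ p (x ∷ xs) ys = trans (cong (p x ∨_) (any-++ p xs ys)) (sym (∨-assoc (p x) _ _))

any-concatMap : ∀ {A B : Set} (p : A → Bool) (f : B → List A) xs → any p (concatMap f xs) ≡ any (any p ∘ f) xs
any-concatMap p f []       = refl
any-concatMap p f (x ∷ xs) = trans (any-++ p (f x) _) (cong (any p (f x) ∨_) (any-concatMap p f xs))

any-∨ : ∀ {A : Set} (p q : A → Bool) xs → any (λ x → p x ∨ q x) xs ≡ any p xs ∨ any q xs
any-∨ p q []       = refl
any-∨ p q (x ∷ xs) = trans (cong ((p x ∨ q x) ∨_) (any-∨ p q xs)) (∨-interchange (p x) (q x) _ _)

any-∧ˡ : ∀ {A : Set} b (p : A → Bool) xs → any (λ x → b ∧ p x) xs ≡ b ∧ any p xs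
any-∧ˡ b p []       = sym (∧-zeroʳ b)
any-∧ˡ b p (x ∷ xs) = trans (cong ((b ∧ p x) ∨_) (any-∧ˡ b p xs)) (sym (∧-distribˡ-∨ b (p x) _))

any-∧ʳ : ∀ {A : Set} b (p : A → Bool) xs → any (λ x → p x ∧ b) xs ≡ any p xs ∧ b
any-∧ʳ b p []       = refl
any-∧ʳ b p (x ∷ xs) = trans (cong ((p x ∧ b) ∨_) (any-∧ʳ b p xs)) (sym (∧-distribʳ-∨ b (p x) _))

any-false : ∀ {A : Set} (xs : List A) → any (λ _ → false) xs ≡ false
any-false []       = refl
any-false (x ∷ xs) = any-false xs

any-comm : ∀ {A B : Set} (r : A → B → Bool) xs ys → any (λ x → any (r x) ys) xs ≡ any (λ y → any (λ x → r x y) xs) ys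
any-comm r []       ys = sym (any-false ys)
any-comm r (x ∷ xs) ys = begin
  any (r x) ys ∨ any (λ x → any (r x) ys) xs           ≡⟨ cong (any (r x) ys ∨_) (any-comm r xs ys) ⟩
  any (r x) ys ∨ any (λ y → any (λ x → r x y) xs) ys   ≡⟨ any-∨ (r x) _ ys ⟨
  any (λ y → r x y ∨ any (λ x → r x y) xs) ys          ∎
  where open ≡-Reasoning

any-upTo : ∀ (f : ℕ → Bool) n → any f (upTo n) ≡ or (applyUpTo f n)
any-upTo f n = cong or (map-upTo f n)

covers : List Bool → ℕ → ℕ × ℕ → Bool
covers bs v (a , b) = ((a ≡ᵇ v) ∧ b ∈ᵇ bs) ∨ ((b ≡ᵇ v) ∧ a ∈ᵇ bs)

any-adj-toSet : ∀ G v bs → any (adj G v) (toSet bs) ≡ any (covers bs v) (edges G)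
any-adj-toSet G v bs = trans (any-comm _ D (edges G)) (any-cong (λ e → edge (proj₁ e) (proj₂ e)) (edges G))
  where
    D = toSet bs
    edge : ∀ a b → any (λ w → ((a ≡ᵇ v) ∧ (b ≡ᵇ w)) ∨ ((a ≡ᵇ w) ∧ (b ≡ᵇ v))) D ≡ covers bs v (a , b)
    edge a b = begin
      any (λ w → ((a ≡ᵇ v) ∧ (b ≡ᵇ w)) ∨ ((a ≡ᵇ w) ∧ (b ≡ᵇ v))) D
        ≡⟨ any-∨ _ _ D ⟩
      any (λ w → (a ≡ᵇ v) ∧ (b ≡ᵇ w)) D ∨ any (λ w → (a ≡ᵇ w) ∧ (b ≡ᵇ v)) D
        ≡⟨ cong₂ _∨_ (any-∧ˡ (a ≡ᵇ v) (b ≡ᵇ_) D) (trans (any-∧ʳ (b ≡ᵇ v) (a ≡ᵇ_) D) (∧-comm (elem a D) _)) ⟩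
      ((a ≡ᵇ v) ∧ elem b D) ∨ ((b ≡ᵇ v) ∧ elem a D)
        ≡⟨ cong₂ (λ x y → ((a ≡ᵇ v) ∧ x) ∨ ((b ≡ᵇ v) ∧ y)) (elem-toSet b bs) (elem-toSet a bs) ⟩
      covers bs v (a , b) ∎
      where open ≡-Reasoning

dominatedBy : List (ℕ × ℕ) → List Bool → ℕ → Bool
dominatedBy E bs v = any (covers bs v) E

dominatesAll : List (ℕ × ℕ) → ℕ → List Bool → Bool
dominatesAll E m bs = all (dominatedBy E bs) (upTo m)

dt≗countBits : ∀ G → dt G ≗ countBits (dominatesAll (edges G) (order G)) (order G)
dt≗countBits G k = begin
  dt G k
    ≡⟨ cong (count _) (subsets-upTo m) ⟩
  count (λ D → isTotalDominating G D ∧ (length D ≡ᵇ k)) (map toSet (bitStrings m))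
    ≡⟨ count-map _ toSet (bitStrings m) ⟩
  count (λ bs → isTotalDominating G (toSet bs) ∧ (length (toSet bs) ≡ᵇ k)) (bitStrings m)
    ≡⟨ count-cong (λ bs → cong₂ (λ d w → d ∧ (w ≡ᵇ k)) (all-cong (λ v → any-adj-toSet G v bs) (upTo m)) (length-toSet bs))
                  (bitStrings m) ⟩
  countBits (dominatesAll (edges G) m) m k ∎
  where
    open ≡-Reasoning
    m = order G

≡ᵇ-scaled : ∀ w .{{_ : NonZero w}} i j → (w * i ≡ᵇ w * j) ≡ (i ≡ᵇ j)
≡ᵇ-scaled w i j with i ≟ j
... | yes refl = trans (≡ᵇ-refl (w * i)) (sym (≡ᵇ-refl i))
... | no i≢j   = trans (≡ᵇ-false (i≢j ∘ *-cancelˡ-≡ i j w)) (sym (≡ᵇ-false i≢j))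

r+w*i≢w*j : ∀ {w r} .{{_ : NonZero w}} → 0 < r → r < w → ∀ i j → r + w * i ≢ w * j
r+w*i≢w*j {w} {r} 0<r r<w i j eq = <⇒≢ 0<r (sym (begin
  r                 ≡⟨ m<n⇒m%n≡m r<w ⟨
  r % w             ≡⟨ [m+kn]%n≡m%n r i w ⟨
  (r + i * w) % w   ≡⟨ cong (λ x → (r + x) % w) (*-comm i w) ⟩
  (r + w * i) % w   ≡⟨ cong (_% w) eq ⟩
  (w * j) % w       ≡⟨ cong (_% w) (*-comm w j) ⟩
  (j * w) % w       ≡⟨ m*n%n≡0 j w ⟩
  0                 ∎))
  where open ≡-Reasoning

≡ᵇ-offsetˡ : ∀ {w r} .{{_ : NonZero w}} → 0 < r → r < w → ∀ i j → (r + w * i ≡ᵇ w * j) ≡ false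
≡ᵇ-offsetˡ 0<r r<w i j = ≡ᵇ-false (r+w*i≢w*j 0<r r<w i j)

≡ᵇ-offsetʳ : ∀ {w r} .{{_ : NonZero w}} → 0 < r → r < w → ∀ i j → (w * i ≡ᵇ r + w * j) ≡ false
≡ᵇ-offsetʳ 0<r r<w i j = ≡ᵇ-false (r+w*i≢w*j 0<r r<w j i ∘ sym)

or-applyUpTo-cong : ∀ {f g : ℕ → Bool} n → (∀ i → i < n → f i ≡ g i) → or (applyUpTo f n) ≡ or (applyUpTo g n)
or-applyUpTo-cong zero    f≗g = refl
or-applyUpTo-cong (suc n) f≗g = cong₂ _∨_ (f≗g 0 z<s) (or-applyUpTo-cong n (λ i i<n → f≗g (suc i) (s<s i<n)))

and-applyUpTo-cong : ∀ {f g : ℕ → Bool} n → (∀ i → i < n → f i ≡ g i) → and (applyUpTo f n) ≡ and (applyUpTo g n)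
and-applyUpTo-cong zero    f≗g = refl
and-applyUpTo-cong (suc n) f≗g = cong₂ _∧_ (f≗g 0 z<s) (and-applyUpTo-cong n (λ i i<n → f≗g (suc i) (s<s i<n)))

or-applyUpTo-false : ∀ n → or (applyUpTo (λ _ → false) n) ≡ false
or-applyUpTo-false zero    = refl
or-applyUpTo-false (suc n) = or-applyUpTo-false n

or-applyUpTo-select : ∀ (h : ℕ → Bool) {n j} → j < n → or (applyUpTo (λ i → (i ≡ᵇ j) ∧ h i) n) ≡ h j
or-applyUpTo-select h {suc n} {zero}  _         = trans (cong (h 0 ∨_) (or-applyUpTo-false n)) (∨-identityʳ (h 0))
or-applyUpTo-select h {suc n} {suc j} (s<s j<n) = or-applyUpTo-select (h ∘ suc) j<n

all-applyUpTo-pairs : ∀ (f : ℕ → Bool) (g : ℕ → ℕ) n →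
  all f (applyUpTo g (2 * n)) ≡ and (applyUpTo (λ i → f (g (2 * i)) ∧ f (g (1 + 2 * i))) n)
all-applyUpTo-pairs f g zero    = refl
all-applyUpTo-pairs f g (suc n) = begin
  all f (applyUpTo g (2 * suc n))
    ≡⟨ cong (all f ∘ applyUpTo g) (*-suc 2 n) ⟩
  f (g 0) ∧ (f (g 1) ∧ all f (applyUpTo (g ∘ (2 +_)) (2 * n)))
    ≡⟨ ∧-assoc (f (g 0)) (f (g 1)) _ ⟨
  (f (g 0) ∧ f (g 1)) ∧ all f (applyUpTo (g ∘ (2 +_)) (2 * n))
    ≡⟨ cong ((f (g 0) ∧ f (g 1)) ∧_) (all-applyUpTo-pairs f (g ∘ (2 +_)) n) ⟩
  (f (g 0) ∧ f (g 1)) ∧ and (applyUpTo (λ i → f (g (2 + 2 * i)) ∧ f (g (3 + 2 * i))) n)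
    ≡⟨ cong ((f (g 0) ∧ f (g 1)) ∧_)
            (and-applyUpTo-cong n (λ i _ → cong (λ x → f (g x) ∧ f (g (suc x))) (sym (*-suc 2 i)))) ⟩
  and (applyUpTo (λ i → f (g (2 * i)) ∧ f (g (1 + 2 * i))) (suc n)) ∎
  where open ≡-Reasoning

all-applyUpTo-triples : ∀ (f : ℕ → Bool) (g : ℕ → ℕ) n →
  all f (applyUpTo g (3 * n)) ≡ and (applyUpTo (λ i → f (g (3 * i)) ∧ (f (g (1 + 3 * i)) ∧ f (g (2 + 3 * i)))) n)
all-applyUpTo-triples f g zero    = refl
all-applyUpTo-triples f g (suc n) = begin
  all f (applyUpTo g (3 * suc n))
    ≡⟨ cong (all f ∘ applyUpTo g) (*-suc 3 n) ⟩
  f (g 0) ∧ (f (g 1) ∧ (f (g 2) ∧ all f (applyUpTo (g ∘ (3 +_)) (3 * n))))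
    ≡⟨ cong (f (g 0) ∧_) (∧-assoc (f (g 1)) (f (g 2)) _) ⟨
  f (g 0) ∧ ((f (g 1) ∧ f (g 2)) ∧ all f (applyUpTo (g ∘ (3 +_)) (3 * n)))
    ≡⟨ ∧-assoc (f (g 0)) (f (g 1) ∧ f (g 2)) _ ⟨
  (f (g 0) ∧ (f (g 1) ∧ f (g 2))) ∧ all f (applyUpTo (g ∘ (3 +_)) (3 * n))
    ≡⟨ cong ((f (g 0) ∧ (f (g 1) ∧ f (g 2))) ∧_) (all-applyUpTo-triples f (g ∘ (3 +_)) n) ⟩
  (f (g 0) ∧ (f (g 1) ∧ f (g 2))) ∧ and (applyUpTo (λ i → f (g (3 + 3 * i)) ∧ (f (g (4 + 3 * i)) ∧ f (g (5 + 3 * i)))) n)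
    ≡⟨ cong ((f (g 0) ∧ (f (g 1) ∧ f (g 2))) ∧_)
            (and-applyUpTo-cong n (λ i _ → cong (λ x → f (g x) ∧ (f (g (1 + x)) ∧ f (g (2 + x)))) (sym (*-suc 3 i)))) ⟩
  and (applyUpTo (λ i → f (g (3 * i)) ∧ (f (g (1 + 3 * i)) ∧ f (g (2 + 3 * i)))) (suc n)) ∎
  where open ≡-Reasoning

T-∧ˡ : ∀ x {y} → T (x ∧ y) → T x
T-∧ˡ true _ = _

T-∧ʳ : ∀ x {y} → T (x ∧ y) → T y
T-∧ʳ true t = t

T-∨-split : ∀ x {y} → T (x ∨ y) → T x ⊎ T y
T-∨-split true  _ = inj₁ _
T-∨-split false t = inj₂ t

T-∨ˡ : ∀ x {y} → T x → T (x ∨ y)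
T-∨ˡ true _ = _

T-∨ʳ : ∀ x {y} → T y → T (x ∨ y)
T-∨ʳ true  _ = _
T-∨ʳ false t = t

∧-absorbed : ∀ {x y} → (T y → T x) → x ∧ y ≡ y
∧-absorbed {true}          _   = refl
∧-absorbed {false} {false} _   = refl
∧-absorbed {false} {true}  y⇒x = ⊥-elim (y⇒x _)

∧-∨-padded : ∀ s x y → (s ∧ x) ∨ (((s ∧ y) ∨ false) ∨ false) ≡ s ∧ (x ∨ y)
∧-∨-padded s x y = trans (cong ((s ∧ x) ∨_) (trans (∨-identityʳ _) (∨-identityʳ _))) (sym (∧-distribˡ-∨ s x y))

-- The n-book graph

-- D_t(B_n, x) = x^(2n) + 2 x^(n+1) (1 + x)^n + x^2 (1 + x)^(2n), the terms counting the sets that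
-- contain neither, exactly one, or both of the hubs u and v.
bookPoly : ℕ → Poly
bookPoly n = monomial (2 * n) ⊕ (shift ^ suc n) (binomial n) ⊕ (shift ^ suc n) (binomial n)
           ⊕ (shift ^ 2) (binomial (2 * n))

bookPoly-rising : ∀ {n} → 2 ≤ n → Rising (bookPoly n) (2 + n)
bookPoly-rising {n} 2≤n = Rising-⊕ (Rising-⊕ (Rising-⊕ monomial-rising pages-rising) pages-rising) core-rising
  where
    2+n≤2n : 2 + n ≤ 2 * n
    2+n≤2n = subst (2 + n ≤_) (cong (n +_) (sym (+-identityʳ n))) (+-monoˡ-≤ n 2≤n)
    monomial-rising : Rising (monomial (2 * n)) (2 + n)
    monomial-rising k k<2+n =
      subst (_≤ monomial (2 * n) (suc k)) (sym (monomial-off (λ 2n≡k → <⇒≱ k<2+n (subst (2 + n ≤_) 2n≡k 2+n≤2n)))) z≤n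
    pages-rising : Rising ((shift ^ suc n) (binomial n)) (2 + n)
    pages-rising = Rising-≤ (≤-reflexive (cong suc (+-comm 1 n)))
                            (Rising-shift^ (suc n) (binomial-rising (s≤s (≤-trans (s≤s z≤n) 2≤n))))
    core-rising : Rising ((shift ^ 2) (binomial (2 * n))) (2 + n)
    core-rising = Rising-shift^ 2 (binomial-rising (n≤1+n (2 * n)))

bookPoly-coeff : ∀ n i → bookPoly n (2 + n + i) ≡ monomial (2 * n) (2 + n + i) + n C suc i + n C suc i + (2 * n) C (n + i)
bookPoly-coeff n i = cong (λ x → monomial (2 * n) (2 + n + i) + x + x + (2 * n) C (n + i)) pages
  where
    pages : (shift ^ suc n) (binomial n) (2 + n + i) ≡ n C suc i
    pages = trans (cong ((shift ^ suc n) (binomial n)) (sym (cong suc (+-suc n i)))) (shift^-at (suc n) (binomial n) (suc i))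

bookPoly-upper : ∀ n i → bookPoly n (2 + n + i) ≤ suc (2 * (n C suc i) + (2 * n) C (n + i))
bookPoly-upper n i = begin
  bookPoly n (2 + n + i)                                                   ≡⟨ bookPoly-coeff n i ⟩
  monomial (2 * n) (2 + n + i) + n C suc i + n C suc i + (2 * n) C (n + i) ≤⟨ +-monoˡ-≤ _ (+-monoˡ-≤ _ (+-monoˡ-≤ _ (monomial-≤1 (2 * n) _))) ⟩
  1 + n C suc i + n C suc i + (2 * n) C (n + i)                            ≡⟨ regroup (n C suc i) _ ⟩
  suc (2 * (n C suc i) + (2 * n) C (n + i))                                ∎
  where
    open ≤-Reasoning
    regroup : ∀ x y → 1 + x + x + y ≡ suc (2 * x + y)
    regroup = solve-∀

bookPoly-lower : ∀ n i → (2 * n) C (n + i) ≤ bookPoly n (2 + n + i)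
bookPoly-lower n i = subst ((2 * n) C (n + i) ≤_) (sym (bookPoly-coeff n i)) (m≤n+m _ _)

bookPoly-top : ∀ n → bookPoly n (2 + n + n) ≡ 1
bookPoly-top n = begin
  bookPoly n (2 + n + n)                                                   ≡⟨ bookPoly-coeff n n ⟩
  monomial (2 * n) (2 + n + n) + n C suc n + n C suc n + (2 * n) C (n + n)
    ≡⟨ cong₂ (λ x y → x + y + y + (2 * n) C (n + n)) (monomial-off (<⇒≢ 2n<2+n+n)) (k>n⇒nCk≡0 {n} ≤-refl) ⟩
  (2 * n) C (n + n)                                                        ≡⟨ cong ((2 * n) C_) 2n≡n+n ⟨
  (2 * n) C (2 * n)                                                        ≡⟨ nCn≡1 (2 * n) ⟩
  1                                                                        ∎
  where
    open ≡-Reasoning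
    2n≡n+n : 2 * n ≡ n + n
    2n≡n+n = cong (n +_) (+-identityʳ n)
    2n<2+n+n : 2 * n < 2 + n + n
    2n<2+n+n = subst (_< 2 + n + n) (sym 2n≡n+n) (m<n+m (n + n) {2} (s≤s z≤n))

-- With n = 2 + t: C(n, 2 + m) C(n, t) ≤ C(2n, n + m) and 3 (n + 1) ≤ C(n, t) once n ≥ 8.
book-gap-weighted : ∀ t m → 6 ≤ t → m ≤ t →
  suc (2 + t + m) * suc (2 * ((2 + t) C (2 + m))) ≤ (2 * m + 1) * ((2 * (2 + t)) C (2 + t + m))
book-gap-weighted t m 6≤t m≤t = begin
  suc (n + m) * suc (2 * X)       ≤⟨ *-monoʳ-≤ (suc (n + m)) (+-monoˡ-≤ (2 * X) 1≤X) ⟩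
  suc (n + m) * (3 * X)           ≤⟨ *-monoˡ-≤ (3 * X) (suc-sum≤ n m) ⟩
  (2 * m + 1) * suc n * (3 * X)   ≡⟨ regroup (2 * m + 1) (suc n) X ⟩
  (2 * m + 1) * X * (3 * suc n)   ≤⟨ *-monoʳ-≤ ((2 * m + 1) * X) (3*[3+t]≤[2+t]Ct t 6≤t) ⟩
  (2 * m + 1) * X * (n C t)       ≡⟨ *-assoc (2 * m + 1) X (n C t) ⟩
  (2 * m + 1) * (X * (n C t))     ≤⟨ *-monoʳ-≤ (2 * m + 1) X*[nCt]≤Y ⟩
  (2 * m + 1) * Y                 ∎
  where
    open ≤-Reasoning
    n = 2 + t
    X = n C (2 + m)
    Y = (2 * n) C (n + m)
    1≤X : 1 ≤ X
    1≤X = nCk>0 (s≤s (s≤s m≤t))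
    suc-sum≤ : ∀ n m → suc (n + m) ≤ (2 * m + 1) * suc n
    suc-sum≤ n m = subst (suc (n + m) ≤_) (expand n m) (m≤m+n (suc (n + m)) (2 * m * n + m))
      where
        expand : ∀ n m → suc (n + m) + (2 * m * n + m) ≡ (2 * m + 1) * suc n
        expand = solve-∀
    regroup : ∀ a b x → a * b * (3 * x) ≡ a * x * (3 * b)
    regroup = solve-∀
    X*[nCt]≤Y : X * (n C t) ≤ Y
    X*[nCt]≤Y = subst₂ (λ a b → X * (n C t) ≤ a C b) (cong (n +_) (sym (+-identityʳ n))) (index t m)
                       (aCr*bCs≤[a+b]C[r+s] n n (2 + m) t)
      where
        index : ∀ t m → 2 + m + t ≡ 2 + t + m
        index = solve-∀

-- Multiplied by n + m + 1, this follows from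
-- (n+m+1) C(2n, n+m+1) + (n+m+1) C(2n, n+m) = (2n+1) C(2n, n+m).
book-gap : ∀ t m → 6 ≤ t → m ≤ t →
  suc (2 * ((2 + t) C (2 + m)) + (2 * (2 + t)) C suc (2 + t + m)) ≤ (2 * (2 + t)) C (2 + t + m)
book-gap t m 6≤t m≤t = *-cancelˡ-≤ a (+-cancelʳ-≤ (a * Y) _ _ (begin
  a * suc (2 * X + Y′) + a * Y       ≡⟨ regroup a (2 * X) Y′ Y ⟩
  a * suc (2 * X) + (a * Y′ + a * Y) ≡⟨ cong (a * suc (2 * X) +_) ([1+k]*nC[1+k]+[1+k]*nCk≡[1+n]*nCk (2 * n) (n + m)) ⟩
  a * suc (2 * X) + suc (2 * n) * Y  ≤⟨ +-monoˡ-≤ (suc (2 * n) * Y) (book-gap-weighted t m 6≤t m≤t) ⟩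
  (2 * m + 1) * Y + suc (2 * n) * Y  ≡⟨ double n m Y ⟩
  a * Y + a * Y                      ∎))
  where
    open ≤-Reasoning
    n = 2 + t
    a = suc (n + m)
    X = n C (2 + m)
    Y = (2 * n) C (n + m)
    Y′ = (2 * n) C suc (n + m)
    regroup : ∀ a y c′ c → a * suc (y + c′) + a * c ≡ a * suc y + (a * c′ + a * c)
    regroup = solve-∀
    double : ∀ n m c → (2 * m + 1) * c + suc (2 * n) * c ≡ suc (n + m) * c + suc (n + m) * c
    double = solve-∀

bookPoly-falling : ∀ t → 6 ≤ t → Falling (bookPoly (2 + t)) (4 + t) (2 + 2 * (2 + t))
bookPoly-falling t 6≤t k 4+t≤k k<2+2n with m<1+n⇒m<n∨m≡n k<2+2n
... | inj₁ k<1+2n = subst (λ k → bookPoly n (suc k) ≤ bookPoly n k) (m+[n∸m]≡n 4+t≤k) (interior (k ∸ (4 + t)) m≤t)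
  where
    n = 2 + t
    m≤t : k ∸ (4 + t) ≤ t
    m≤t = ≤-trans (∸-monoˡ-≤ (4 + t) (s≤s⁻¹ k<1+2n))
                  (≤-reflexive (trans (cong (_∸ (4 + t)) (double t)) (m+n∸m≡n (4 + t) t)))
      where
        double : ∀ t → 2 * (2 + t) ≡ 4 + t + t
        double = solve-∀
    interior : ∀ m → m ≤ t → bookPoly n (suc (2 + n + m)) ≤ bookPoly n (2 + n + m)
    interior m m≤t = begin
      bookPoly n (suc (2 + n + m))                       ≡⟨ cong (bookPoly n) (+-suc (2 + n) m) ⟨
      bookPoly n (2 + n + suc m)                         ≤⟨ bookPoly-upper n (suc m) ⟩
      suc (2 * (n C (2 + m)) + (2 * n) C (n + suc m))    ≡⟨ cong (λ x → suc (2 * (n C (2 + m)) + (2 * n) C x)) (+-suc n m) ⟩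
      suc (2 * (n C (2 + m)) + (2 * n) C suc (n + m))    ≤⟨ book-gap t m 6≤t m≤t ⟩
      (2 * n) C (n + m)                                  ≤⟨ bookPoly-lower n m ⟩
      bookPoly n (2 + n + m)                             ∎
      where open ≤-Reasoning
... | inj₂ refl = begin
  bookPoly n (2 + 2 * n)          ≡⟨ cong (bookPoly n) (top-index t) ⟩
  bookPoly n (2 + n + n)          ≡⟨ bookPoly-top n ⟩
  1                               ≤⟨ nCk>0 (≤-trans (n≤1+n _) (≤-reflexive (below-top-index t))) ⟩
  (2 * n) C (n + suc t)           ≤⟨ bookPoly-lower n (suc t) ⟩
  bookPoly n (2 + n + suc t)      ≡⟨ cong (bookPoly n) (penultimate-index t) ⟩
  bookPoly n (1 + 2 * n)          ∎
  where
    open ≤-Reasoning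
    n = 2 + t
    top-index : ∀ t → 2 + 2 * (2 + t) ≡ 2 + (2 + t) + (2 + t)
    top-index = solve-∀
    below-top-index : ∀ t → suc ((2 + t) + suc t) ≡ 2 * (2 + t)
    below-top-index = solve-∀
    penultimate-index : ∀ t → 2 + (2 + t) + suc t ≡ 1 + 2 * (2 + t)
    penultimate-index = solve-∀

bookPoly-unimodal : ∀ n → 1 ≤ n → Unimodal (2 + 2 * n) (bookPoly n)
bookPoly-unimodal 1 _ = unimodal-with-peak (bookPoly 1) 3 _
bookPoly-unimodal 2 _ = unimodal-with-peak (bookPoly 2) 4 _
bookPoly-unimodal 3 _ = unimodal-with-peak (bookPoly 3) 5 _
bookPoly-unimodal 4 _ = unimodal-with-peak (bookPoly 4) 6 _
bookPoly-unimodal 5 _ = unimodal-with-peak (bookPoly 5) 7 _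
bookPoly-unimodal 6 _ = unimodal-with-peak (bookPoly 6) 8 _
bookPoly-unimodal 7 _ = unimodal-with-peak (bookPoly 7) 9 _
bookPoly-unimodal (suc (suc (suc (suc (suc (suc (suc (suc u)))))))) _ =
  4 + t , peak≤top t , bookPoly-rising (s≤s (s≤s z≤n)) , bookPoly-falling t (m≤m+n 6 u)
  where
    t = 6 + u
    peak≤top : ∀ t → 4 + t ≤ 2 + 2 * (2 + t)
    peak≤top t = subst (4 + t ≤_) (expand t) (m≤m+n (4 + t) (2 + t))
      where
        expand : ∀ t → 4 + t + (2 + t) ≡ 2 + 2 * (2 + t)
        expand = solve-∀

pageEdges : ℕ → List (ℕ × ℕ)
pageEdges i = (0 , 2 + 2 * i) ∷ (2 + 2 * i , 3 + 2 * i) ∷ (3 + 2 * i , 1) ∷ []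

pageDominated : Bool → Bool → Bool → Bool → Bool
pageDominated u v a b = (u ∨ b) ∧ (a ∨ v)

pagesDominated : Bool → Bool → List Bool → ℕ → Bool
pagesDominated u v ps n = and (applyUpTo (λ i → pageDominated u v ((2 * i) ∈ᵇ ps) ((1 + 2 * i) ∈ᵇ ps)) n)

module _ (n : ℕ) (bs : List Bool) where

  private
    u v : Bool
    u = 0 ∈ᵇ bs
    v = 1 ∈ᵇ bs
    a b : ℕ → Bool
    a i = (2 + 2 * i) ∈ᵇ bs
    b i = (3 + 2 * i) ∈ᵇ bs

    -- For w ≥ 2, any (covers bs w) (pageEdges i) reduces to pathCovers i (2 + 2 * i ≡ᵇ w) (3 + 2 * i ≡ᵇ w).
    pathCovers : ℕ → Bool → Bool → Bool
    pathCovers i isA isB = (isA ∧ u) ∨ (((isA ∧ b i) ∨ (isB ∧ a i)) ∨ (((isB ∧ v) ∨ false) ∨ false))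

  dominatedBy-book : ∀ w → dominatedBy (edges (bookGraph n)) bs w ≡ covers bs w (0 , 1) ∨ or (applyUpTo (λ i → any (covers bs w) (pageEdges i)) n)
  dominatedBy-book w = cong (covers bs w (0 , 1) ∨_) (trans (any-concatMap _ pageEdges (upTo n)) (any-upTo _ n))

  book-dominates-a : ∀ {j} → j < n → dominatedBy (edges (bookGraph n)) bs (2 + 2 * j) ≡ 0 ∈ᵇ bs ∨ (3 + 2 * j) ∈ᵇ bs
  book-dominates-a {j} j<n =
    trans (dominatedBy-book (2 + 2 * j)) (trans (or-applyUpTo-cong n (λ i _ → page i)) (or-applyUpTo-select _ j<n))
    where
      page : ∀ i → pathCovers i (2 * i ≡ᵇ 2 * j) (1 + 2 * i ≡ᵇ 2 * j) ≡ (i ≡ᵇ j) ∧ (u ∨ b i)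
      page i rewrite ≡ᵇ-scaled 2 i j | ≡ᵇ-offsetˡ {2} {1} z<s (s<s z<s) i j = ∧-∨-padded (i ≡ᵇ j) u (b i)

  book-dominates-b : ∀ {j} → j < n → dominatedBy (edges (bookGraph n)) bs (3 + 2 * j) ≡ (2 + 2 * j) ∈ᵇ bs ∨ 1 ∈ᵇ bs
  book-dominates-b {j} j<n =
    trans (dominatedBy-book (3 + 2 * j)) (trans (or-applyUpTo-cong n (λ i _ → page i)) (or-applyUpTo-select _ j<n))
    where
      page : ∀ i → pathCovers i (2 * i ≡ᵇ 1 + 2 * j) (2 * i ≡ᵇ 2 * j) ≡ (i ≡ᵇ j) ∧ (a i ∨ v)
      page i rewrite ≡ᵇ-scaled 2 i j | ≡ᵇ-offsetʳ {2} {1} z<s (s<s z<s) i j = ∧-∨-padded (i ≡ᵇ j) (a i) v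

-- Page 0 alone already forces a neighbour of each hub into the set, so for n ≥ 1 the hub
-- conditions are absorbed by the page conditions.
dominatesAll-book : ∀ n u v ps →
  dominatesAll (edges (bookGraph (suc n))) (2 + 2 * suc n) (u ∷ v ∷ ps) ≡ pagesDominated u v ps (suc n)
dominatesAll-book n u v ps = begin
  dominatesAll (edges (bookGraph N)) (2 + 2 * N) bs
    ≡⟨ cong (λ rest → dom 0 ∧ (dom 1 ∧ rest)) (trans (all-applyUpTo-pairs dom (2 +_) N) (and-applyUpTo-cong N pages)) ⟩
  dom 0 ∧ (dom 1 ∧ pagesDominated u v ps N) ≡⟨ cong (dom 0 ∧_) (∧-absorbed v-dominated) ⟩
  dom 0 ∧ pagesDominated u v ps N           ≡⟨ ∧-absorbed u-dominated ⟩
  pagesDominated u v ps N                   ∎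
  where
    open ≡-Reasoning
    N = suc n
    bs = u ∷ v ∷ ps
    dom = dominatedBy (edges (bookGraph N)) bs
    a₀ = 0 ∈ᵇ ps
    b₀ = 1 ∈ᵇ ps
    pages : ∀ i → i < N → dom (2 + 2 * i) ∧ dom (3 + 2 * i) ≡ pageDominated u v ((2 * i) ∈ᵇ ps) ((1 + 2 * i) ∈ᵇ ps)
    pages i i<N = cong₂ _∧_ (book-dominates-a N bs i<N) (book-dominates-b N bs i<N)
    page₀ : T (pagesDominated u v ps N) → T (pageDominated u v a₀ b₀)
    page₀ = T-∧ˡ (pageDominated u v a₀ b₀)
    -- dom 0 unfolds to (v ∨ false) ∨ ((a₀ ∨ false) ∨ …) and dom 1 to u ∨ (b₀ ∨ …).
    u-dominated : T (pagesDominated u v ps N) → T (dom 0)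
    u-dominated ok with T-∨-split a₀ (T-∧ʳ (u ∨ b₀) (page₀ ok))
    ... | inj₁ a₀∈ = T-∨ʳ (v ∨ false) (T-∨ˡ (a₀ ∨ false) (T-∨ˡ a₀ a₀∈))
    ... | inj₂ v∈  = T-∨ˡ (v ∨ false) (T-∨ˡ v v∈)
    v-dominated : T (pagesDominated u v ps N) → T (dom 1)
    v-dominated ok with T-∨-split u (T-∧ˡ (u ∨ b₀) (page₀ ok))
    ... | inj₁ u∈  = T-∨ˡ u u∈
    ... | inj₂ b₀∈ = T-∨ʳ u (T-∨ˡ b₀ b₀∈)

pagesDominated-step : ∀ u v a b ps n →
  pagesDominated u v (a ∷ b ∷ ps) (suc n) ≡ pageDominated u v a b ∧ pagesDominated u v ps n
pagesDominated-step u v a b ps n = cong (pageDominated u v a b ∧_) (and-applyUpTo-cong n (λ i _ →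
  cong (λ x → pageDominated u v (x ∈ᵇ (a ∷ b ∷ ps)) (suc x ∈ᵇ (a ∷ b ∷ ps))) (*-suc 2 i)))

pagesCount : Bool → Bool → ℕ → Poly
pagesCount u v n = countBits (λ ps → pagesDominated u v ps n) (2 * n)

pagesCount-suc : ∀ u v n → pagesCount u v (suc n) ≗
  countBits (λ ps → pageDominated u v false false ∧ pagesDominated u v ps n) (2 * n)
  ⊕ shift (countBits (λ ps → pageDominated u v false true ∧ pagesDominated u v ps n) (2 * n))
  ⊕ shift (countBits (λ ps → pageDominated u v true false ∧ pagesDominated u v ps n) (2 * n)
           ⊕ shift (countBits (λ ps → pageDominated u v true true ∧ pagesDominated u v ps n) (2 * n)))
pagesCount-suc u v n k = begin
  countBits Φ (2 * suc n) k ≡⟨ cong (λ m → countBits Φ m k) (*-suc 2 n) ⟩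
  countBits Φ (2 + 2 * n) k ≡⟨ countBits-cons₂ Φ (2 * n) k ⟩
  _                         ≡⟨ ⊕-cong (⊕-cong (step false false) (shift-cong (step false true)))
                                      (shift-cong (⊕-cong (step true false) (shift-cong (step true true)))) k ⟩
  _                         ∎
  where
    open ≡-Reasoning
    Φ = λ ps → pagesDominated u v ps (suc n)
    step : ∀ a b → countBits (λ ps → Φ (a ∷ b ∷ ps)) (2 * n) ≗ countBits (λ ps → pageDominated u v a b ∧ pagesDominated u v ps n) (2 * n)
    step a b = countBits-cong (λ ps → pagesDominated-step u v a b ps n) (2 * n)

pagesCount-both : ∀ n → pagesCount true true n ≗ binomial (2 * n)
pagesCount-both zero    = λ { zero → refl ; (suc k) → refl }
pagesCount-both (suc n) k = begin
  pagesCount true true (suc n) k                  ≡⟨ pagesCount-suc true true n k ⟩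
  onePlusX (onePlusX (pagesCount true true n)) k  ≡⟨ onePlusX-cong (onePlusX-cong (pagesCount-both n)) k ⟩
  onePlusX (onePlusX (binomial (2 * n))) k        ≡⟨ onePlusX-cong (binomial-suc (2 * n)) k ⟨
  onePlusX (binomial (1 + 2 * n)) k               ≡⟨ binomial-suc (1 + 2 * n) k ⟨
  binomial (2 + 2 * n) k                          ≡⟨ cong (λ m → binomial m k) (*-suc 2 n) ⟨
  binomial (2 * suc n) k                          ∎
  where open ≡-Reasoning

pagesCount-u : ∀ n → pagesCount true false n ≗ (shift ^ n) (binomial n)
pagesCount-u zero    = λ { zero → refl ; (suc k) → refl }
pagesCount-u (suc n) k = begin
  pagesCount true false (suc n) k                ≡⟨ pagesCount-suc true false n k ⟩
  Z k + shift Z k + shift (onePlusX P) k         ≡⟨ drop-zeros k ⟩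
  shift (onePlusX P) k                           ≡⟨ shift-cong (onePlusX-cong (pagesCount-u n)) k ⟩
  shift (onePlusX ((shift ^ n) (binomial n))) k  ≡⟨ shift-cong (^-commute shift-cong {G = onePlusX} (λ f → sym ∘ onePlusX-shift f) n (binomial n)) k ⟨
  shift ((shift ^ n) (onePlusX (binomial n))) k  ≡⟨ shift-cong (^-cong shift-cong n (binomial-suc n)) k ⟨
  (shift ^ suc n) (binomial (suc n)) k           ∎
  where
    open ≡-Reasoning
    P = pagesCount true false n
    Z = countBits (λ _ → false) (2 * n)
    drop-zeros : ∀ k → Z k + shift Z k + shift (onePlusX P) k ≡ shift (onePlusX P) k
    drop-zeros zero    rewrite countBits-false (2 * n) 0 = refl
    drop-zeros (suc k) rewrite countBits-false (2 * n) k = refl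

pagesCount-v : ∀ n → pagesCount false true n ≗ (shift ^ n) (binomial n)
pagesCount-v zero    = λ { zero → refl ; (suc k) → refl }
pagesCount-v (suc n) k = begin
  pagesCount false true (suc n) k                ≡⟨ pagesCount-suc false true n k ⟩
  Z k + shift P k + shift (Z ⊕ shift P) k        ≡⟨ drop-zeros k ⟩
  shift (onePlusX P) k                           ≡⟨ shift-cong (onePlusX-cong (pagesCount-v n)) k ⟩
  shift (onePlusX ((shift ^ n) (binomial n))) k  ≡⟨ shift-cong (^-commute shift-cong {G = onePlusX} (λ f → sym ∘ onePlusX-shift f) n (binomial n)) k ⟨
  shift ((shift ^ n) (onePlusX (binomial n))) k  ≡⟨ shift-cong (^-cong shift-cong n (binomial-suc n)) k ⟨
  (shift ^ suc n) (binomial (suc n)) k           ∎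
  where
    open ≡-Reasoning
    P = pagesCount false true n
    Z = countBits (λ _ → false) (2 * n)
    drop-zeros : ∀ k → Z k + shift P k + shift (Z ⊕ shift P) k ≡ shift (onePlusX P) k
    drop-zeros zero    rewrite countBits-false (2 * n) 0 = refl
    drop-zeros (suc k) rewrite countBits-false (2 * n) k = refl

pagesCount-none : ∀ n → pagesCount false false n ≗ monomial (2 * n)
pagesCount-none zero    = λ { zero → refl ; (suc k) → refl }
pagesCount-none (suc n) k = begin
  pagesCount false false (suc n) k               ≡⟨ pagesCount-suc false false n k ⟩
  Z k + shift Z k + shift (Z ⊕ shift P) k        ≡⟨ drop-zeros k ⟩
  shift (shift P) k                              ≡⟨ shift-cong (shift-cong (pagesCount-none n)) k ⟩
  shift (shift (monomial (2 * n))) k             ≡⟨ trans (shift-cong (shift-monomial (2 * n)) k) (shift-monomial (1 + 2 * n) k) ⟩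
  monomial (2 + 2 * n) k                         ≡⟨ cong (λ m → monomial m k) (*-suc 2 n) ⟨
  monomial (2 * suc n) k                         ∎
  where
    open ≡-Reasoning
    P = pagesCount false false n
    Z = countBits (λ _ → false) (2 * n)
    drop-zeros : ∀ k → Z k + shift Z k + shift (Z ⊕ shift P) k ≡ shift (shift P) k
    drop-zeros zero    rewrite countBits-false (2 * n) 0 = refl
    drop-zeros (suc k) rewrite countBits-false (2 * n) k = refl

dt-book : ∀ n → dt (bookGraph (suc n)) ≗ bookPoly (suc n)
dt-book n k = begin
  dt (bookGraph N) k
    ≡⟨ dt≗countBits (bookGraph N) k ⟩
  countBits (dominatesAll E (2 + 2 * N)) (2 + 2 * N) k
    ≡⟨ countBits-cons₂ _ (2 * N) k ⟩
  (Q false false ⊕ shift (Q false true) ⊕ shift (Q true false ⊕ shift (Q true true))) k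
    ≡⟨ ⊕-cong (⊕-cong (hubs false false) (shift-cong (hubs false true)))
              (shift-cong (⊕-cong (hubs true false) (shift-cong (hubs true true)))) k ⟩
  (monomial (2 * N) ⊕ shift ((shift ^ N) (binomial N)) ⊕ shift ((shift ^ N) (binomial N) ⊕ shift (binomial (2 * N)))) k
    ≡⟨ cong (monomial (2 * N) k + (shift ^ suc N) (binomial N) k +_) (shift-⊕ ((shift ^ N) (binomial N)) _ k) ⟩
  monomial (2 * N) k + (shift ^ suc N) (binomial N) k + ((shift ^ suc N) (binomial N) k + (shift ^ 2) (binomial (2 * N)) k)
    ≡⟨ +-assoc (monomial (2 * N) k + (shift ^ suc N) (binomial N) k) _ _ ⟨
  bookPoly N k ∎
  where
    open ≡-Reasoning
    N = suc n
    E = edges (bookGraph N)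
    Q : Bool → Bool → Poly
    Q u v = countBits (λ ps → dominatesAll E (2 + 2 * N) (u ∷ v ∷ ps)) (2 * N)
    closed : Bool → Bool → Poly
    closed false false = monomial (2 * N)
    closed true  true  = binomial (2 * N)
    closed _     _     = (shift ^ N) (binomial N)
    closed-form : ∀ u v → pagesCount u v N ≗ closed u v
    closed-form false false = pagesCount-none N
    closed-form false true  = pagesCount-v N
    closed-form true  false = pagesCount-u N
    closed-form true  true  = pagesCount-both N
    hubs : ∀ u v → Q u v ≗ closed u v
    hubs u v k = trans (countBits-cong (dominatesAll-book n u v) (2 * N) k) (closed-form u v k)

-- The generalized friendship graph F_{n,4}

-- D_t(F_{p+1,4}, x) = x^(p+2) (2 + x)^(p+1) ((1 + x)^(p+1) + x^p): the centre is in the set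
-- (x^(p+2) (2 + x)^(p+1) (1 + x)^(p+1)) or not (x^(2p+2) (2 + x)^(p+1)).
friendshipPoly : ℕ → Poly
friendshipPoly p = (shift ^ (2 + p)) ((twoPlusX ^ suc p) (binomial (suc p) ⊕ monomial p))

binomial⊕monomial-off : ∀ n p i → p ≢ i → (binomial n ⊕ monomial p) i ≡ n C i
binomial⊕monomial-off n p i p≢i = trans (cong (n C i +_) (monomial-off p≢i)) (+-identityʳ (n C i))

binomial⊕monomial-diag : ∀ n p → (binomial n ⊕ monomial p) p ≡ suc (n C p)
binomial⊕monomial-diag n p = trans (cong (n C p +_) (monomial-diag p)) (+-comm (n C p) 1)

-- Only at the three indices next to p does the added x^p matter.
logConcave-binomial⊕monomial : ∀ p → LogConcave (binomial (suc p) ⊕ monomial p)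
logConcave-binomial⊕monomial p k with p ≟ 2 + k | p ≟ 1 + k | p ≟ k
... | yes refl | _ | _ = begin
  f k * f (2 + k)               ≡⟨ cong₂ _*_ (trans (binomial⊕monomial-off (3 + k) (2 + k) k (λ ())) ([r+k]Ck≡[r+k]Cr 3 k)) top ⟩
  ((3 + k) C 3) * suc (3 + k)   ≤⟨ nC3*[1+n]≤nC2² (3 + k) ⟩
  ((3 + k) C 2) * ((3 + k) C 2) ≡⟨ cong₂ _*_ middle middle ⟨
  f (1 + k) * f (1 + k)         ∎
  where
    open ≤-Reasoning
    f = binomial (3 + k) ⊕ monomial (2 + k)
    middle : f (1 + k) ≡ (3 + k) C 2
    middle = trans (binomial⊕monomial-off (3 + k) (2 + k) (1 + k) (λ ())) ([r+k]Ck≡[r+k]Cr 2 (1 + k))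
    top : f (2 + k) ≡ suc (3 + k)
    top = trans (binomial⊕monomial-diag (3 + k) (2 + k)) (cong suc (trans ([r+k]Ck≡[r+k]Cr 1 (2 + k)) (nC1≡n (3 + k))))
... | no _ | yes refl | _ = begin
  f k * f (2 + k)                         ≡⟨ cong₂ _*_ (binomial⊕monomial-off (2 + k) (1 + k) k (λ ())) (binomial⊕monomial-off (2 + k) (1 + k) (2 + k) (λ ())) ⟩
  ((2 + k) C k) * ((2 + k) C (2 + k))     ≤⟨ logConcave-binomial (2 + k) k ⟩
  ((2 + k) C (1 + k)) * ((2 + k) C (1 + k)) ≤⟨ *-mono-≤ (n≤1+n ((2 + k) C (1 + k))) (n≤1+n ((2 + k) C (1 + k))) ⟩
  suc ((2 + k) C (1 + k)) * suc ((2 + k) C (1 + k)) ≡⟨ cong₂ _*_ peak peak ⟨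
  f (1 + k) * f (1 + k)                   ∎
  where
    open ≤-Reasoning
    f = binomial (2 + k) ⊕ monomial (1 + k)
    peak : f (1 + k) ≡ suc ((2 + k) C (1 + k))
    peak = binomial⊕monomial-diag (2 + k) (1 + k)
... | no _ | no _ | yes refl = begin
  f k * f (2 + k)       ≡⟨ cong (f k *_) (trans (binomial⊕monomial-off (1 + k) k (2 + k) (λ ())) (k>n⇒nCk≡0 {1 + k} {2 + k} ≤-refl)) ⟩
  f k * 0               ≡⟨ *-zeroʳ (f k) ⟩
  0                     ≤⟨ z≤n ⟩
  f (1 + k) * f (1 + k) ∎
  where
    open ≤-Reasoning
    f = binomial (1 + k) ⊕ monomial k
... | no p≢2+k | no p≢1+k | no p≢k = begin
  f k * f (2 + k)                           ≡⟨ cong₂ _*_ (binomial⊕monomial-off (suc p) p k p≢k) (binomial⊕monomial-off (suc p) p (2 + k) p≢2+k) ⟩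
  (suc p C k) * (suc p C (2 + k))           ≤⟨ logConcave-binomial (suc p) k ⟩
  (suc p C (1 + k)) * (suc p C (1 + k))     ≡⟨ cong₂ _*_ (binomial⊕monomial-off (suc p) p (1 + k) p≢1+k) (binomial⊕monomial-off (suc p) p (1 + k) p≢1+k) ⟨
  f (1 + k) * f (1 + k)                     ∎
  where
    open ≤-Reasoning
    f = binomial (suc p) ⊕ monomial p

support-binomial⊕monomial : ∀ p → Support (binomial (suc p) ⊕ monomial p) 0 (suc p)
support-binomial⊕monomial p = record
  { lo≤hi      = z≤n
  ; positive   = λ _ k≤1+p → ≤-trans (nCk>0 k≤1+p) (m≤m+n _ _)
  ; zero-below = λ ()
  ; zero-above = λ 1+p<k → cong₂ _+_ (k>n⇒nCk≡0 1+p<k) (monomial-off (<⇒≢ (<-trans (n<1+n p) 1+p<k)))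
  }

friendshipPoly-unimodal : ∀ p N → Unimodal N (friendshipPoly p)
friendshipPoly-unimodal p = logConcave⇒unimodal (proj₁ lc) (proj₂ lc)
  where
    lc : LogConcaveOn (friendshipPoly p) (2 + p + 0) (2 + p + (suc p + suc p))
    lc = logConcave-shift^ (2 + p) (logConcave-mulLinear^ {2} {1} (s≤s z≤n) (s≤s z≤n) (suc p)
           (logConcave-binomial⊕monomial p , support-binomial⊕monomial p))

cycleEdges : ℕ → List (ℕ × ℕ)
cycleEdges i = (0 , 1 + 3 * i) ∷ (1 + 3 * i , 2 + 3 * i) ∷ (2 + 3 * i , 3 + 3 * i) ∷ (3 + 3 * i , 0) ∷ []

cycleDominated : Bool → Bool → Bool → Bool → Bool
cycleDominated c a b d = (c ∨ b) ∧ ((a ∨ d) ∧ (b ∨ c))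

cyclesDominated : Bool → List Bool → ℕ → Bool
cyclesDominated c ps n = and (applyUpTo (λ i → cycleDominated c ((3 * i) ∈ᵇ ps) ((1 + 3 * i) ∈ᵇ ps) ((2 + 3 * i) ∈ᵇ ps)) n)

module _ (n : ℕ) (bs : List Bool) where

  private
    c : Bool
    c = 0 ∈ᵇ bs
    a b d : ℕ → Bool
    a i = (1 + 3 * i) ∈ᵇ bs
    b i = (2 + 3 * i) ∈ᵇ bs
    d i = (3 + 3 * i) ∈ᵇ bs

    -- For w ≥ 1, any (covers bs w) (cycleEdges i) reduces to
    -- cycleCovers i (1 + 3 * i ≡ᵇ w) (2 + 3 * i ≡ᵇ w) (3 + 3 * i ≡ᵇ w).
    cycleCovers : ℕ → Bool → Bool → Bool → Bool
    cycleCovers i isA isB isD =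
      (isA ∧ c) ∨ (((isA ∧ b i) ∨ (isB ∧ a i)) ∨ (((isB ∧ d i) ∨ (isD ∧ b i)) ∨ (((isD ∧ c) ∨ false) ∨ false)))

  dominatedBy-friendship : ∀ w → dominatedBy (edges (friendshipGraph4 n)) bs w ≡ or (applyUpTo (λ i → any (covers bs w) (cycleEdges i)) n)
  dominatedBy-friendship w = trans (any-concatMap _ cycleEdges (upTo n)) (any-upTo _ n)

  friendship-dominates-a : ∀ {j} → j < n → dominatedBy (edges (friendshipGraph4 n)) bs (1 + 3 * j) ≡ 0 ∈ᵇ bs ∨ (2 + 3 * j) ∈ᵇ bs
  friendship-dominates-a {j} j<n =
    trans (dominatedBy-friendship (1 + 3 * j)) (trans (or-applyUpTo-cong n (λ i _ → cycle i)) (or-applyUpTo-select _ j<n))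
    where
      cycle : ∀ i → cycleCovers i (3 * i ≡ᵇ 3 * j) (1 + 3 * i ≡ᵇ 3 * j) (2 + 3 * i ≡ᵇ 3 * j) ≡ (i ≡ᵇ j) ∧ (c ∨ b i)
      cycle i rewrite ≡ᵇ-scaled 3 i j | ≡ᵇ-offsetˡ {3} {1} z<s (s<s z<s) i j | ≡ᵇ-offsetˡ {3} {2} z<s (s<s (s<s z<s)) i j =
        ∧-∨-padded (i ≡ᵇ j) c (b i)

  friendship-dominates-b : ∀ {j} → j < n → dominatedBy (edges (friendshipGraph4 n)) bs (2 + 3 * j) ≡ (1 + 3 * j) ∈ᵇ bs ∨ (3 + 3 * j) ∈ᵇ bs
  friendship-dominates-b {j} j<n =
    trans (dominatedBy-friendship (2 + 3 * j)) (trans (or-applyUpTo-cong n (λ i _ → cycle i)) (or-applyUpTo-select _ j<n))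
    where
      cycle : ∀ i → cycleCovers i (3 * i ≡ᵇ 1 + 3 * j) (3 * i ≡ᵇ 3 * j) (1 + 3 * i ≡ᵇ 3 * j) ≡ (i ≡ᵇ j) ∧ (a i ∨ d i)
      cycle i rewrite ≡ᵇ-scaled 3 i j | ≡ᵇ-offsetʳ {3} {1} z<s (s<s z<s) i j | ≡ᵇ-offsetˡ {3} {1} z<s (s<s z<s) i j =
        ∧-∨-padded (i ≡ᵇ j) (a i) (d i)

  friendship-dominates-d : ∀ {j} → j < n → dominatedBy (edges (friendshipGraph4 n)) bs (3 + 3 * j) ≡ (2 + 3 * j) ∈ᵇ bs ∨ 0 ∈ᵇ bs
  friendship-dominates-d {j} j<n =
    trans (dominatedBy-friendship (3 + 3 * j)) (trans (or-applyUpTo-cong n (λ i _ → cycle i)) (or-applyUpTo-select _ j<n))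
    where
      cycle : ∀ i → cycleCovers i (3 * i ≡ᵇ 2 + 3 * j) (3 * i ≡ᵇ 1 + 3 * j) (3 * i ≡ᵇ 3 * j) ≡ (i ≡ᵇ j) ∧ (b i ∨ c)
      cycle i rewrite ≡ᵇ-scaled 3 i j | ≡ᵇ-offsetʳ {3} {1} z<s (s<s z<s) i j | ≡ᵇ-offsetʳ {3} {2} z<s (s<s (s<s z<s)) i j =
        ∧-∨-padded (i ≡ᵇ j) (b i) c

-- As for the book, cycle 0 forces a neighbour of the centre into the set.
dominatesAll-friendship : ∀ n c ps →
  dominatesAll (edges (friendshipGraph4 (suc n))) (1 + 3 * suc n) (c ∷ ps) ≡ cyclesDominated c ps (suc n)
dominatesAll-friendship n c ps = begin
  dominatesAll (edges (friendshipGraph4 N)) (1 + 3 * N) bs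
    ≡⟨ cong (dom 0 ∧_) (trans (all-applyUpTo-triples dom suc N) (and-applyUpTo-cong N cycles)) ⟩
  dom 0 ∧ cyclesDominated c ps N ≡⟨ ∧-absorbed centre-dominated ⟩
  cyclesDominated c ps N         ∎
  where
    open ≡-Reasoning
    N = suc n
    bs = c ∷ ps
    dom = dominatedBy (edges (friendshipGraph4 N)) bs
    a₀ = 0 ∈ᵇ ps
    b₀ = 1 ∈ᵇ ps
    d₀ = 2 ∈ᵇ ps
    cycles : ∀ i → i < N → dom (1 + 3 * i) ∧ (dom (2 + 3 * i) ∧ dom (3 + 3 * i))
                           ≡ cycleDominated c ((3 * i) ∈ᵇ ps) ((1 + 3 * i) ∈ᵇ ps) ((2 + 3 * i) ∈ᵇ ps)
    cycles i i<N = cong₂ _∧_ (friendship-dominates-a N bs i<N)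
                             (cong₂ _∧_ (friendship-dominates-b N bs i<N) (friendship-dominates-d N bs i<N))
    -- dom 0 unfolds to (a₀ ∨ false) ∨ (d₀ ∨ …).
    centre-dominated : T (cyclesDominated c ps N) → T (dom 0)
    centre-dominated ok
      with T-∨-split a₀ (T-∧ˡ (a₀ ∨ d₀) (T-∧ʳ (c ∨ b₀) (T-∧ˡ (cycleDominated c a₀ b₀ d₀) ok)))
    ... | inj₁ a₀∈ = T-∨ˡ (a₀ ∨ false) (T-∨ˡ a₀ a₀∈)
    ... | inj₂ d₀∈ = T-∨ʳ (a₀ ∨ false) (T-∨ˡ d₀ d₀∈)

cyclesDominated-step : ∀ c a b d ps n →
  cyclesDominated c (a ∷ b ∷ d ∷ ps) (suc n) ≡ cycleDominated c a b d ∧ cyclesDominated c ps n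
cyclesDominated-step c a b d ps n = cong (cycleDominated c a b d ∧_) (and-applyUpTo-cong n (λ i _ →
  cong (λ x → cycleDominated c (x ∈ᵇ qs) (suc x ∈ᵇ qs) ((2 + x) ∈ᵇ qs)) (*-suc 3 i)))
  where qs = a ∷ b ∷ d ∷ ps

cyclesCount : Bool → ℕ → Poly
cyclesCount c n = countBits (λ ps → cyclesDominated c ps n) (3 * n)

cyclePart : Bool → ℕ → Bool → Bool → Bool → Poly
cyclePart c n a b d = countBits (λ ps → cycleDominated c a b d ∧ cyclesDominated c ps n) (3 * n)

cyclesCount-suc : ∀ c n → let Q = cyclePart c n in cyclesCount c (suc n) ≗
  (Q false false false ⊕ shift (Q false false true) ⊕ shift (Q false true false ⊕ shift (Q false true true)))
  ⊕ shift (Q true false false ⊕ shift (Q true false true) ⊕ shift (Q true true false ⊕ shift (Q true true true)))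
cyclesCount-suc c n k = begin
  countBits Φ (3 * suc n) k ≡⟨ cong (λ m → countBits Φ m k) (*-suc 3 n) ⟩
  countBits Φ (3 + 3 * n) k ≡⟨ countBits-cons₃ Φ (3 * n) k ⟩
  _                         ≡⟨ ⊕-cong (⊕-cong (⊕-cong (step false false false) (shift-cong (step false false true)))
                                              (shift-cong (⊕-cong (step false true false) (shift-cong (step false true true)))))
                                      (shift-cong (⊕-cong (⊕-cong (step true false false) (shift-cong (step true false true)))
                                              (shift-cong (⊕-cong (step true true false) (shift-cong (step true true true)))))) k ⟩
  _                         ∎
  where
    open ≡-Reasoning
    Φ = λ ps → cyclesDominated c ps (suc n)
    step : ∀ a b d → countBits (λ ps → Φ (a ∷ b ∷ d ∷ ps)) (3 * n) ≗ cyclePart c n a b d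
    step a b d = countBits-cong (λ ps → cyclesDominated-step c a b d ps n) (3 * n)

cyclesCount-noCentre-suc : ∀ n → cyclesCount false (suc n) ≗ shift (shift (twoPlusX (cyclesCount false n)))
cyclesCount-noCentre-suc n k = trans (cyclesCount-suc false n k) (drop-zeros k)
  where
    P = cyclesCount false n
    Z = countBits (λ _ → false) (3 * n)
    drop-zeros : ∀ k → ((Z ⊕ shift Z ⊕ shift (Z ⊕ shift P)) ⊕ shift (Z ⊕ shift Z ⊕ shift (P ⊕ shift P))) k
                       ≡ shift (shift (twoPlusX P)) k
    drop-zeros zero          rewrite countBits-false (3 * n) 0 = refl
    drop-zeros (suc zero)    rewrite countBits-false (3 * n) 0 = refl
    drop-zeros (suc (suc k)) rewrite countBits-false (3 * n) k = double (P k) (shift P k)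
      where
        double : ∀ x y → x + (x + y) ≡ 2 * x + 1 * y
        double = solve-∀

cyclesCount-centre-suc : ∀ n → cyclesCount true (suc n) ≗ shift (twoPlusX (onePlusX (cyclesCount true n)))
cyclesCount-centre-suc n k = trans (cyclesCount-suc true n k) (drop-zeros k)
  where
    P = cyclesCount true n
    Z = countBits (λ _ → false) (3 * n)
    drop-zeros : ∀ k → ((Z ⊕ shift P ⊕ shift (Z ⊕ shift P)) ⊕ shift (P ⊕ shift P ⊕ shift (P ⊕ shift P))) k
                       ≡ shift (twoPlusX (onePlusX P)) k
    drop-zeros zero    rewrite countBits-false (3 * n) 0 = refl
    drop-zeros (suc k) rewrite countBits-false (3 * n) k = double (P k + shift P k) (shift (onePlusX P) k)
      where
        double : ∀ x y → x + (x + y) ≡ 2 * x + 1 * y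
        double = solve-∀

cyclesCount-noCentre : ∀ n → cyclesCount false n ≗ (shift ^ n) ((twoPlusX ^ n) (monomial n))
cyclesCount-noCentre zero    = λ { zero → refl ; (suc k) → refl }
cyclesCount-noCentre (suc n) k = begin
  cyclesCount false (suc n) k                                      ≡⟨ cyclesCount-noCentre-suc n k ⟩
  shift (shift (twoPlusX (cyclesCount false n))) k                 ≡⟨ shift-cong (shift-cong (twoPlusX-cong (cyclesCount-noCentre n))) k ⟩
  shift (shift (twoPlusX ((shift ^ n) X))) k                       ≡⟨ shift-cong (shift-cong (^-commute shift-cong {G = twoPlusX} shift-twoPlusX n X)) k ⟨
  shift (shift ((shift ^ n) (twoPlusX X))) k                       ≡⟨ shift-cong (^-commute shift-cong {G = shift} (λ _ _ → refl) n _) k ⟨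
  shift ((shift ^ n) (shift ((twoPlusX ^ suc n) (monomial n)))) k  ≡⟨ shift-cong (^-cong shift-cong n (^-commute twoPlusX-cong {G = shift} twoPlusX-shift (suc n) (monomial n))) k ⟨
  shift ((shift ^ n) ((twoPlusX ^ suc n) (shift (monomial n)))) k  ≡⟨ shift-cong (^-cong shift-cong n (^-cong twoPlusX-cong (suc n) (shift-monomial n))) k ⟩
  (shift ^ suc n) ((twoPlusX ^ suc n) (monomial (suc n))) k        ∎
  where
    open ≡-Reasoning
    X = (twoPlusX ^ n) (monomial n)

cyclesCount-centre : ∀ n → cyclesCount true n ≗ (shift ^ n) ((twoPlusX ^ n) (binomial n))
cyclesCount-centre zero    = λ { zero → refl ; (suc k) → refl }
cyclesCount-centre (suc n) k = begin
  cyclesCount true (suc n) k                                          ≡⟨ cyclesCount-centre-suc n k ⟩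
  shift (twoPlusX (onePlusX (cyclesCount true n))) k                  ≡⟨ shift-cong (twoPlusX-cong (onePlusX-cong (cyclesCount-centre n))) k ⟩
  shift (twoPlusX (onePlusX ((shift ^ n) X))) k                       ≡⟨ shift-cong (twoPlusX-cong (^-commute shift-cong {G = onePlusX} (λ f → sym ∘ onePlusX-shift f) n X)) k ⟨
  shift (twoPlusX ((shift ^ n) (onePlusX X))) k                       ≡⟨ shift-cong (^-commute shift-cong {G = twoPlusX} shift-twoPlusX n (onePlusX X)) k ⟨
  shift ((shift ^ n) (twoPlusX (onePlusX X))) k                       ≡⟨ shift-cong (^-cong shift-cong n (twoPlusX-cong (^-commute twoPlusX-cong {G = onePlusX} twoPlusX-onePlusX n (binomial n)))) k ⟨
  shift ((shift ^ n) ((twoPlusX ^ suc n) (onePlusX (binomial n)))) k  ≡⟨ shift-cong (^-cong shift-cong n (^-cong twoPlusX-cong (suc n) (binomial-suc n))) k ⟨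
  (shift ^ suc n) ((twoPlusX ^ suc n) (binomial (suc n))) k           ∎
  where
    open ≡-Reasoning
    X = (twoPlusX ^ n) (binomial n)

dt-friendship : ∀ p → dt (friendshipGraph4 (suc p)) ≗ friendshipPoly p
dt-friendship p k = begin
  dt (friendshipGraph4 N) k
    ≡⟨ dt≗countBits (friendshipGraph4 N) k ⟩
  countBits (dominatesAll E (1 + 3 * N)) (1 + 3 * N) k
    ≡⟨ countBits-suc _ (3 * N) k ⟩
  countBits (λ ps → dominatesAll E (1 + 3 * N) (false ∷ ps)) (3 * N) k
    + shift (countBits (λ ps → dominatesAll E (1 + 3 * N) (true ∷ ps)) (3 * N)) k
    ≡⟨ cong₂ _+_ (trans (countBits-cong (dominatesAll-friendship p false) (3 * N) k) (cyclesCount-noCentre N k))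
                 (shift-cong (λ k → trans (countBits-cong (dominatesAll-friendship p true) (3 * N) k) (cyclesCount-centre N k)) k) ⟩
  (shift ^ N) ((twoPlusX ^ N) (monomial N)) k + (shift ^ suc N) ((twoPlusX ^ N) (binomial N)) k
    ≡⟨ cong (_+ (shift ^ suc N) ((twoPlusX ^ N) (binomial N)) k) centre-excluded ⟩
  (shift ^ suc N) ((twoPlusX ^ N) (monomial p)) k + (shift ^ suc N) ((twoPlusX ^ N) (binomial N)) k
    ≡⟨ +-comm ((shift ^ suc N) ((twoPlusX ^ N) (monomial p)) k) _ ⟩
  (shift ^ suc N) ((twoPlusX ^ N) (binomial N)) k + (shift ^ suc N) ((twoPlusX ^ N) (monomial p)) k
    ≡⟨ ^-distrib-⊕ shift-cong shift-⊕ (suc N) _ _ k ⟨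
  (shift ^ suc N) ((twoPlusX ^ N) (binomial N) ⊕ (twoPlusX ^ N) (monomial p)) k
    ≡⟨ ^-cong shift-cong (suc N) (^-distrib-⊕ twoPlusX-cong twoPlusX-⊕ N (binomial N) (monomial p)) k ⟨
  friendshipPoly p k ∎
  where
    open ≡-Reasoning
    N = suc p
    E = edges (friendshipGraph4 N)
    centre-excluded : (shift ^ N) ((twoPlusX ^ N) (monomial N)) k ≡ (shift ^ suc N) ((twoPlusX ^ N) (monomial p)) k
    centre-excluded = begin
      (shift ^ N) ((twoPlusX ^ N) (monomial N)) k         ≡⟨ ^-cong shift-cong N (^-cong twoPlusX-cong N (shift-monomial p)) k ⟨
      (shift ^ N) ((twoPlusX ^ N) (shift (monomial p))) k ≡⟨ ^-cong shift-cong N (^-commute twoPlusX-cong {G = shift} twoPlusX-shift N (monomial p)) k ⟩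
      (shift ^ N) (shift ((twoPlusX ^ N) (monomial p))) k ≡⟨ ^-commute shift-cong {G = shift} (λ _ _ → refl) N _ k ⟩
      (shift ^ suc N) ((twoPlusX ^ N) (monomial p)) k     ∎


book-unimodal : ∀ n → TotalDomPolyUnimodal (bookGraph n)
book-unimodal zero    = unimodal-with-peak (dt (bookGraph 0)) 2 _
book-unimodal (suc n) = Unimodal-resp-≗ _ (λ k → sym (dt-book n k)) (bookPoly-unimodal (suc n) (s≤s z≤n))

friendship-unimodal : ∀ n → TotalDomPolyUnimodal (friendshipGraph4 n)
friendship-unimodal zero    = unimodal-with-peak (dt (friendshipGraph4 0)) 0 _
friendship-unimodal (suc p) = Unimodal-resp-≗ _ (λ k → sym (dt-friendship p k)) (friendshipPoly-unimodal p _)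

mainTheorem9 : (n : ℕ) → TotalDomPolyUnimodal (bookGraph n) × TotalDomPolyUnimodal (friendshipGraph4 n)
mainTheorem9 n = book-unimodal n , friendship-unimodal n
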